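{- If $M,N$ are typed terms and $M\to^* N$, then $[\![M]\!]=[\![N]\!]$, i.e. $[\![M]\!]\varepsilon=[\![N]\!]\varepsilon$ for every environment $\varepsilon$.
   Context: Types: type expressions $\sigma ::= t \mid \sigma+\sigma \mid \sigma\times\sigma\mid \sigma\to\sigma\mid \mu t.\sigma\mid \mathrm{void}$; types are closed type expressions; simple types $\tau::=\mathrm{void}\mid\tau+\tau\mid\tau\times\tau\mid\tau\to\tau$. $\preceq$: least relation with $\mathrm{void}\preceq\tau$ and $\sigma\preceq\sigma',\tau\preceq\tau'\Rightarrow\sigma\star\tau\preceq\sigma'\star\tau'$ ($\star\in\{+,\times,\to\}$, $\sigma,\tau$ simple). Unfolding $\rhd$: least relation with $\mu t.\tau\rhd\tau[\mu t.\tau/t]$, closed under $\star$ in either argument; $\tau\!\uparrow=\{\sigma\text{ simple}\mid\exists\tau'(\tau\rhd^*\tau',\sigma\preceq\tau')\}$. Type trees are non-empty, downward closed, directed sets of simple types; $\tau\!\uparrow$ is one. $\sigma\approx\tau$ iff $\sigma\!\uparrow=\tau\!\uparrow$. For type trees $\mathrm{void}=\{\mathrm{void}\}$, $\sigma\star\tau=\{\mathrm{void}\}\cup\{\sigma'\star\tau'\mid\sigma'\in\sigma,\tau'\in\tau\}$. Terms: variables $x^\sigma$ for each type $\sigma$; constants for all types $\sigma,\tau,\rho$: $0_{\sigma,\tau}:\sigma\to(\sigma+\tau)$, $1_{\sigma,\tau}:\tau\to(\sigma+\tau)$, $\mathrm{case}_{\sigma,\tau,\rho}:(\sigma+\tau)\to(\sigma\to\rho)\to(\tau\to\rho)\to\rho$,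 $\mathrm{pcase}_{\sigma,\tau,\rho}:(\sigma+\tau)\to\rho\to\rho\to\rho$, $\mathrm{pair}_{\sigma,\tau}:\sigma\to\tau\to(\sigma\times\tau)$, $\mathrm{fst}_{\sigma,\tau}:(\sigma\times\tau)\to\sigma$, $\mathrm{snd}_{\sigma,\tau}:(\sigma\times\tau)\to\tau$, $\Omega_\sigma:\sigma$. Typing: constants have their types; $x^\sigma:\sigma$; $M:\tau\Rightarrow\lambda x^\sigma.M:\sigma\to\tau$; $M:\sigma\to\tau,N:\sigma\Rightarrow MN:\tau$; $M:\sigma,\sigma\approx\tau\Rightarrow M:\tau$. Terms modulo $\alpha$-conversion; $(M,N)=\mathrm{pair}\,M\,N$. Reduction $\to$: least relation containing $\beta$ ($(\lambda x.M)N\to M[x:=N]$), closed under application in either position and under $\lambda$, and containing (for arbitrary terms $x,y,z,w,y_i,z_i$): $\mathrm{case}(0x)yz\to yx$; $\mathrm{case}(1x)yz\to zx$; $\mathrm{fst}(x,y)\to x$; $\mathrm{snd}(x,y)\to y$; $\mathrm{pcase}(0x)yz\to y$; $\mathrm{pcase}(1x)yz\to z$; $\mathrm{pcase}_{\sigma,\tau,\rho_0+\rho_1}x(0y)(0z)\to 0(\mathrm{pcase}_{\sigma,\tau,\rho_0}xyz)$; $\mathrm{pcase}_{\sigma,\tau,\rho_0+\rho_1}x(1y)(1z)\to 1(\mathrm{pcase}_{\sigma,\tau,\rho_1}xyz)$; $\mathrm{pcase}_{\sigma,\tau,\rho_1\times\rho_2}x(y_1,y_2)(z_1,z_2)\to(\mathrm{pcase}\,x\,y_1z_1,\mathrm{pcase}\,x\,y_2z_2)$;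 $(\mathrm{pcase}_{\sigma,\tau,\rho_1\to\rho_2}xyz)w\to\mathrm{pcase}_{\sigma,\tau,\rho_2}x(yw)(zw)$. $\to^*$: reflexive transitive closure. Semantics: a prime system $(A,\asymp,\le)$ has a set $A$ of primes, a reflexive symmetric consistency $\asymp$, a partial order $\le$, with $a\asymp b, c\le b\Rightarrow a\asymp c$. Its elements are the downward closed, pairwise consistent subsets of $A$, ordered by $\subseteq$; $\bot=\emptyset$; $\downarrow X=\{a\mid\exists b\in X,a\le b\}$. Sum $\mathbf A_0+\mathbf A_1$: primes $B_0\cup B_1$, $B_i=\{i\}\cup(\{i\}\times A_i)$; $a\asymp b$ iff both lie in one $B_i$ and, if $a=(i,a'),b=(i,b')$, $a'\asymp_ib'$; $a\le b$ iff ($a=i$, $b\in B_i$) or ($a=(i,a'),b=(i,b'),a'\le_ib'$). Product $\mathbf A_0\times\mathbf A_1$: primes $(\{0\}\times A_0)\cup(\{1\}\times A_1)$; $(i,a)\asymp(j,b)$ iff $i\ne j$ or $a\asymp_ib$; $(i,a)\le(j,b)$ iff $i=j$, $a\le_ib$. Function space $\mathbf A\to\mathbf B$: primes $(X,b)$, $X\subseteq A$ finite, pairwise consistent and pairwise $\le$-incomparable, $b\in B$; $(X,a)\asymp(Y,b)$ iff (all of $X$ consistent with all of $Y$ implies $a\asymp b$); $(X,a)\le(Y,b)$ iff $Y\subseteq\downarrow X$ and $a\le b$. An element $r$ of $\mathbf A\to\mathbf B$ denotes the continuous function $r\,d=\{a\mid\exists X\subseteq d,(X,a)\in r\}$; this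 is an order isomorphism onto the continuous functions between element domains, with inverse $\mathrm{Pr}(f)=\{(X,a)\mid a\in f(\downarrow X)\}$; curried functions of several arguments are converted by applying $\mathrm{Pr}$ iteratively. $\mathbf 0=(\emptyset,\emptyset,\emptyset)$. For a type tree $\sigma$: $\mathbf P_0(\sigma)=\mathbf 0$, $\mathbf P_{n+1}(\mathrm{void})=\mathbf 0$, $\mathbf P_{n+1}(\sigma\star\tau)=\mathbf P_n(\sigma)\star\mathbf P_n(\tau)$; these form an increasing chain (each prime set contains the previous one, with relations restricting), and $\mathbf P(\sigma)$ is its union (union of prime sets and of relations). $D_\sigma$ is the set of elements of $\mathbf P(\sigma)$; for a type $\sigma$, $D_\sigma=D_{\sigma\uparrow}$. In $D_{\sigma+\tau}$: $0d=\{0\}\cup(\{0\}\times d)$, $1d=\{1\}\cup(\{1\}\times d)$; in $D_{\sigma\times\tau}$: $\mathrm{pair}\,d\,e=(\{0\}\times d)\cup(\{1\}\times e)$. An environment $\varepsilon$ maps each variable $x^\sigma$ to an element of $D_\sigma$; $\varepsilon[x\mapsto d]$ updates $\varepsilon$ at $x$. The semantics: $[\![0]\!]\varepsilon=\mathrm{Pr}(d\mapsto 0d)$, $[\![1]\!]\varepsilon=\mathrm{Pr}(d\mapsto 1d)$; $[\![\mathrm{case}]\!]\varepsilon$ is (via $\mathrm{Pr}$) the function with $\mathrm{case}\,d\,f\,g=\bot$ if $d=\bot$, $=f\,e$ if $d=0e$, $=g\,e$ if $d=1e$; $[\![\mathrm{pcase}]\!]\varepsilon$ is the function with $\mathrm{pcase}\,a\,b\,c=b\cap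 c$ if $a=\bot$, $=b$ if $a=0a'$, $=c$ if $a=1a'$; $[\![\mathrm{pair}]\!]\varepsilon$ corresponds to $(d,e)\mapsto\mathrm{pair}\,d\,e$; $[\![\mathrm{fst}]\!]\varepsilon$, $[\![\mathrm{snd}]\!]\varepsilon$ correspond to $\mathrm{pair}\,d\,e\mapsto d$, resp. $e$; $[\![\Omega]\!]\varepsilon=\bot$; $[\![x]\!]\varepsilon=\varepsilon(x)$; $[\![\lambda x^\sigma.M]\!]\varepsilon=\mathrm{Pr}(d\in D_\sigma\mapsto[\![M]\!](\varepsilon[x\mapsto d]))$; $[\![MN]\!]\varepsilon=([\![M]\!]\varepsilon)([\![N]\!]\varepsilon)$. -}

module Defs where

open import Data.Nat using (ℕ; zero; suc; pred; _<ᵇ_; _≡ᵇ_)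
open import Data.Fin using (Fin; zero; suc)
open import Data.Bool using (if_then_else_)
open import Data.List using (List; []; _∷_)
open import Data.List.Relation.Unary.All using (All)
open import Data.List.Relation.Unary.Any using (Any)
open import Data.List.Relation.Unary.AllPairs using (AllPairs)
open import Data.Product using (Σ; ∃; ∃₂; _×_; _,_)
open import Data.Sum using (_⊎_)
open import Data.Empty using (⊥)
open import Data.Unit using (⊤)
open import Relation.Nullary using (¬_)
open import Relation.Binary.PropositionalEquality using (_≡_; _≢_)
open import Relation.Binary.Construct.Closure.ReflexiveTransitive using (Star)

-- Type expressions (de Bruijn: Ty n has n free type variables)

infixr 7 _⊗_
infixr 6 _⊕_
infixr 5 _⇒_

data Ty (n : ℕ) : Set where
  tvar : Fin n → Ty n
  _⊕_  : Ty n → Ty n → Ty n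
  _⊗_  : Ty n → Ty n → Ty n
  _⇒_  : Ty n → Ty n → Ty n
  μ    : Ty (suc n) → Ty n
  void : Ty n

Type : Set
Type = Ty 0

renT : ∀ {n m} → (Fin n → Fin m) → Ty n → Ty m
renT r (tvar i) = tvar (r i)
renT r (a ⊕ b) = renT r a ⊕ renT r b
renT r (a ⊗ b) = renT r a ⊗ renT r b
renT r (a ⇒ b) = renT r a ⇒ renT r b
renT r (μ a) = μ (renT (λ { zero → zero ; (suc i) → suc (r i) }) a)
renT r void = void

subT : ∀ {n m} → (Fin n → Ty m) → Ty n → Ty m
subT s (tvar i) = s i
subT s (a ⊕ b) = subT s a ⊕ subT s b
subT s (a ⊗ b) = subT s a ⊗ subT s b
subT s (a ⇒ b) = subT s a ⇒ subT s b
subT s (μ a) = μ (subT (λ { zero → tvar zero ; (suc i) → renT suc (s i) }) a)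
subT s void = void

-- τ[u/t] for the outermost bound variable t
_[_]ᵀ : ∀ {n} → Ty (suc n) → Ty n → Ty n
τ [ u ]ᵀ = subT (λ { zero → u ; (suc i) → tvar i }) τ

data STy : Set where
  svoid : STy
  _⊕ˢ_ _⊗ˢ_ _⇒ˢ_ : STy → STy → STy

data _⪯_ : STy → Type → Set where
  void⪯ : ∀ {τ} → svoid ⪯ τ
  ⊕⪯ : ∀ {s t σ τ} → s ⪯ σ → t ⪯ τ → (s ⊕ˢ t) ⪯ (σ ⊕ τ)
  ⊗⪯ : ∀ {s t σ τ} → s ⪯ σ → t ⪯ τ → (s ⊗ˢ t) ⪯ (σ ⊗ τ)
  ⇒⪯ : ∀ {s t σ τ} → s ⪯ σ → t ⪯ τ → (s ⇒ˢ t) ⪯ (σ ⇒ τ)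

data _▷_ : Type → Type → Set where
  unfold : ∀ {τ} → μ τ ▷ (τ [ μ τ ]ᵀ)
  ⊕ˡ : ∀ {σ σ' τ} → σ ▷ σ' → (σ ⊕ τ) ▷ (σ' ⊕ τ)
  ⊕ʳ : ∀ {σ τ τ'} → τ ▷ τ' → (σ ⊕ τ) ▷ (σ ⊕ τ')
  ⊗ˡ : ∀ {σ σ' τ} → σ ▷ σ' → (σ ⊗ τ) ▷ (σ' ⊗ τ)
  ⊗ʳ : ∀ {σ τ τ'} → τ ▷ τ' → (σ ⊗ τ) ▷ (σ ⊗ τ')
  ⇒ˡ : ∀ {σ σ' τ} → σ ▷ σ' → (σ ⇒ τ) ▷ (σ' ⇒ τ)
  ⇒ʳ : ∀ {σ τ τ'} → τ ▷ τ' → (σ ⇒ τ) ▷ (σ ⇒ τ')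

-- type trees are represented as predicates on simple types
TypeTree : Set₁
TypeTree = STy → Set

_↑ : Type → TypeTree
(τ ↑) s = ∃ λ τ' → Star _▷_ τ τ' × s ⪯ τ'

_≈_ : Type → Type → Set
σ ≈ τ = ∀ s → ((σ ↑) s → (τ ↑) s) × ((τ ↑) s → (σ ↑) s)

-- Terms (de Bruijn indices; a variable carries its type annotation.
-- An index i under d binders with i ≥ d is the free variable x^σ with
-- name i ∸ d, where σ is the annotation.)

data Const : Set where
  c0 c1 : Type → Type → Const
  ccase cpcase : Type → Type → Type → Const
  cpair cfst csnd : Type → Type → Const
  cΩ : Type → Const

data Tm : Set where
  v   : ℕ → Type → Tm
  con : Const → Tm
  lam : Type → Tm → Tm
  app : Tm → Tm → Tm

infixl 9 _·_
_·_ : Tm → Tm → Tm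
_·_ = app

typeOf : Const → Type
typeOf (c0 σ τ) = σ ⇒ (σ ⊕ τ)
typeOf (c1 σ τ) = τ ⇒ (σ ⊕ τ)
typeOf (ccase σ τ ρ) = (σ ⊕ τ) ⇒ (σ ⇒ ρ) ⇒ (τ ⇒ ρ) ⇒ ρ
typeOf (cpcase σ τ ρ) = (σ ⊕ τ) ⇒ ρ ⇒ ρ ⇒ ρ
typeOf (cpair σ τ) = σ ⇒ τ ⇒ (σ ⊗ τ)
typeOf (cfst σ τ) = (σ ⊗ τ) ⇒ σ
typeOf (csnd σ τ) = (σ ⊗ τ) ⇒ τ
typeOf (cΩ σ) = σ

-- a de Bruijn variable i with annotation σ is well formed in context Γ
-- (the types of the enclosing binders, innermost first) if, when bound,
-- its annotation is the binder's annotation; free variables are unconstrained.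
VarOK : List Type → ℕ → Type → Set
VarOK [] i σ = ⊤
VarOK (τ ∷ Γ) zero σ = τ ≡ σ
VarOK (τ ∷ Γ) (suc i) σ = VarOK Γ i σ

data _⊢_∶_ (Γ : List Type) : Tm → Type → Set where
  tv   : ∀ {i σ} → VarOK Γ i σ → Γ ⊢ v i σ ∶ σ
  tcon : ∀ {c} → Γ ⊢ con c ∶ typeOf c
  tlam : ∀ {σ τ M} → (σ ∷ Γ) ⊢ M ∶ τ → Γ ⊢ lam σ M ∶ (σ ⇒ τ)
  tapp : ∀ {σ τ M N} → Γ ⊢ M ∶ (σ ⇒ τ) → Γ ⊢ N ∶ σ → Γ ⊢ app M N ∶ τ
  tconv : ∀ {σ τ M} → Γ ⊢ M ∶ σ → σ ≈ τ → Γ ⊢ M ∶ τ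

Typed : Tm → Set
Typed M = ∃ λ σ → [] ⊢ M ∶ σ

shift : ℕ → Tm → Tm
shift c (v i σ) = if i <ᵇ c then v i σ else v (suc i) σ
shift c (con k) = con k
shift c (lam σ M) = lam σ (shift (suc c) M)
shift c (app M N) = app (shift c M) (shift c N)

-- sub k N M : replace index k by N (N already shifted k times), decrement higher indices
sub : ℕ → Tm → Tm → Tm
sub k N (v i σ) = if i <ᵇ k then v i σ else (if i ≡ᵇ k then N else v (pred i) σ)
sub k N (con c) = con c
sub k N (lam σ M) = lam σ (sub (suc k) (shift 0 N) M)
sub k N (app M M') = app (sub k N M) (sub k N M')

-- M[x:=N] for the variable bound by the outermost λ of λx.M
_[0:=_] : Tm → Tm → Tm
M [0:= N ] = sub 0 N M

infix 4 _⟶_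
data _⟶_ : Tm → Tm → Set where
  β      : ∀ {σ M N} → app (lam σ M) N ⟶ M [0:= N ]
  appˡ   : ∀ {M M' N} → M ⟶ M' → app M N ⟶ app M' N
  appʳ   : ∀ {M N N'} → N ⟶ N' → app M N ⟶ app M N'
  lamξ   : ∀ {σ M M'} → M ⟶ M' → lam σ M ⟶ lam σ M'
  case0  : ∀ {σ τ ρ α β x y z} →
           con (ccase σ τ ρ) · (con (c0 α β) · x) · y · z ⟶ y · x
  case1  : ∀ {σ τ ρ α β x y z} →
           con (ccase σ τ ρ) · (con (c1 α β) · x) · y · z ⟶ z · x
  fstβ   : ∀ {σ τ α β x y} → con (cfst σ τ) · (con (cpair α β) · x · y) ⟶ x
  sndβ   : ∀ {σ τ α β x y} → con (csnd σ τ) · (con (cpair α β) · x · y) ⟶ y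
  pcase0 : ∀ {σ τ ρ α β x y z} →
           con (cpcase σ τ ρ) · (con (c0 α β) · x) · y · z ⟶ y
  pcase1 : ∀ {σ τ ρ α β x y z} →
           con (cpcase σ τ ρ) · (con (c1 α β) · x) · y · z ⟶ z
  pcase⊕0 : ∀ {σ τ ρ₀ ρ₁ α β α' β' x y z} →
           con (cpcase σ τ (ρ₀ ⊕ ρ₁)) · x · (con (c0 α β) · y) · (con (c0 α' β') · z)
           ⟶ con (c0 ρ₀ ρ₁) · (con (cpcase σ τ ρ₀) · x · y · z)
  pcase⊕1 : ∀ {σ τ ρ₀ ρ₁ α β α' β' x y z} →
           con (cpcase σ τ (ρ₀ ⊕ ρ₁)) · x · (con (c1 α β) · y) · (con (c1 α' β') · z)
           ⟶ con (c1 ρ₀ ρ₁) · (con (cpcase σ τ ρ₁) · x · y · z)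
  pcase⊗ : ∀ {σ τ ρ₁ ρ₂ α β α' β' x y₁ y₂ z₁ z₂} →
           con (cpcase σ τ (ρ₁ ⊗ ρ₂)) · x · (con (cpair α β) · y₁ · y₂)
                                         · (con (cpair α' β') · z₁ · z₂)
           ⟶ con (cpair ρ₁ ρ₂) · (con (cpcase σ τ ρ₁) · x · y₁ · z₁)
                                · (con (cpcase σ τ ρ₂) · x · y₂ · z₂)
  pcase⇒ : ∀ {σ τ ρ₁ ρ₂ x y z w} →
           con (cpcase σ τ (ρ₁ ⇒ ρ₂)) · x · y · z · w
           ⟶ con (cpcase σ τ ρ₂) · x · (y · w) · (z · w)

infix 4 _⟶*_
_⟶*_ : Tm → Tm → Set
_⟶*_ = Star _⟶_

-- All prime systems P(σ) live inside one universe of primes: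
--   tag i      : the sum prime i
--   inj i a    : the sum prime (i,a)
--   prj i a    : the product prime (i,a)
--   fn X a     : the function-space prime (X,a), X a finite set given as a list
-- Consistency and order are defined structurally, exactly as in the
-- sum / product / function-space constructions.

data Prime : Set where
  tag : Fin 2 → Prime
  inj : Fin 2 → Prime → Prime
  prj : Fin 2 → Prime → Prime
  fn  : List Prime → Prime → Prime

infix 4 _≍_ _⊑_

mutual
  _≍_ : Prime → Prime → Set
  tag i ≍ tag j = i ≡ j
  tag i ≍ inj j b = i ≡ j
  inj i a ≍ tag j = i ≡ j
  inj i a ≍ inj j b = i ≡ j × a ≍ b
  prj i a ≍ prj j b = i ≢ j ⊎ (i ≡ j × a ≍ b)
  fn X a ≍ fn Y b = AllCons X Y → a ≍ b
  _ ≍ _ = ⊥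

  AllCons : List Prime → List Prime → Set
  AllCons [] Y = ⊤
  AllCons (x ∷ X) Y = ConsWith x Y × AllCons X Y

  ConsWith : Prime → List Prime → Set
  ConsWith x [] = ⊤
  ConsWith x (y ∷ Y) = (x ≍ y) × ConsWith x Y

mutual
  _⊑_ : Prime → Prime → Set
  tag i ⊑ tag j = i ≡ j
  tag i ⊑ inj j b = i ≡ j
  inj i a ⊑ inj j b = i ≡ j × a ⊑ b
  prj i a ⊑ prj j b = i ≡ j × a ⊑ b
  fn X a ⊑ fn Y b = Below Y X × a ⊑ b
  _ ⊑ _ = ⊥

  -- Below Y X :  Y ⊆ ↓X
  Below : List Prime → List Prime → Set
  Below [] X = ⊤
  Below (y ∷ Y) X = SomeAbove y X × Below Y X

  SomeAbove : Prime → List Prime → Set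
  SomeAbove y [] = ⊥
  SomeAbove y (x ∷ X) = (y ⊑ x) ⊎ SomeAbove y X

Indep : List Prime → Set
Indep = AllPairs (λ x y → (x ≍ y) × ¬ (x ⊑ y) × ¬ (y ⊑ x))

SumTree ProdTree FunTree : TypeTree → Set
SumTree T = ∃₂ λ s t → T (s ⊕ˢ t)
ProdTree T = ∃₂ λ s t → T (s ⊗ˢ t)
FunTree T = ∃₂ λ s t → T (s ⇒ˢ t)

sumComp prodComp : Fin 2 → TypeTree → TypeTree
sumComp zero T s = ∃ λ t → T (s ⊕ˢ t)
sumComp (suc zero) T t = ∃ λ s → T (s ⊕ˢ t)
prodComp zero T s = ∃ λ t → T (s ⊗ˢ t)
prodComp (suc zero) T t = ∃ λ s → T (s ⊗ˢ t)

funDom funCod : TypeTree → TypeTree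
funDom T s = ∃ λ t → T (s ⇒ˢ t)
funCod T t = ∃ λ s → T (s ⇒ˢ t)

Pn : ℕ → TypeTree → Prime → Set
Pn zero T p = ⊥
Pn (suc n) T (tag i) = SumTree T
Pn (suc n) T (inj i a) = SumTree T × Pn n (sumComp i T) a
Pn (suc n) T (prj i a) = ProdTree T × Pn n (prodComp i T) a
Pn (suc n) T (fn X a) =
  FunTree T × All (Pn n (funDom T)) X × Indep X × Pn n (funCod T) a

PP : TypeTree → Prime → Set
PP T p = ∃ λ n → Pn n T p

PSet : Set₁
PSet = Prime → Set

IsElem : TypeTree → PSet → Set
IsElem T d = (∀ p → d p → PP T p)
           × (∀ p q → d q → PP T p → p ⊑ q → d p)
           × (∀ p q → d p → d q → p ≍ q)

_≐_ : PSet → PSet → Set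
d ≐ e = ∀ p → (d p → e p) × (e p → d p)

down : TypeTree → List Prime → PSet
down T X a = PP T a × Any (a ⊑_) X

PrF : TypeTree → (PSet → PSet) → PSet
PrF T f (fn X a) = All (PP T) X × Indep X × f (down T X) a
PrF T f _ = ⊥

apply : PSet → PSet → PSet
apply r d a = ∃ λ X → All d X × r (fn X a)

inD : Fin 2 → PSet → PSet
inD i d (tag j) = j ≡ i
inD i d (inj j a) = j ≡ i × d a
inD i d _ = ⊥

-- the e with d = i e
outD : Fin 2 → PSet → PSet
outD i d a = d (inj i a)

pairD : PSet → PSet → PSet
pairD d e (prj zero a) = d a
pairD d e (prj (suc zero) a) = e a
pairD d e _ = ⊥

caseD : PSet → PSet → PSet → PSet
caseD d f g a = (d (tag zero) × apply f (outD zero d) a)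
              ⊎ (d (tag (suc zero)) × apply g (outD (suc zero) d) a)

pcaseD : PSet → PSet → PSet → PSet
pcaseD a b c p = ((∀ q → ¬ a q) × b p × c p)
               ⊎ (a (tag zero) × b p)
               ⊎ (a (tag (suc zero)) × c p)

⟦_⟧ᶜ : Const → PSet
⟦ c0 σ τ ⟧ᶜ = PrF (σ ↑) (inD zero)
⟦ c1 σ τ ⟧ᶜ = PrF (τ ↑) (inD (suc zero))
⟦ ccase σ τ ρ ⟧ᶜ = PrF ((σ ⊕ τ) ↑) λ d → PrF ((σ ⇒ ρ) ↑) λ f → PrF ((τ ⇒ ρ) ↑) λ g → caseD d f g
⟦ cpcase σ τ ρ ⟧ᶜ = PrF ((σ ⊕ τ) ↑) λ a → PrF (ρ ↑) λ b → PrF (ρ ↑) λ c → pcaseD a b c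
⟦ cpair σ τ ⟧ᶜ = PrF (σ ↑) λ d → PrF (τ ↑) λ e → pairD d e
⟦ cfst σ τ ⟧ᶜ = PrF ((σ ⊗ τ) ↑) λ p a → p (prj zero a)
⟦ csnd σ τ ⟧ᶜ = PrF ((σ ⊗ τ) ↑) λ p a → p (prj (suc zero) a)
⟦ cΩ σ ⟧ᶜ = λ _ → ⊥

-- environments: variable x^σ (name i, type σ) ↦ set of primes
Env : Set₁
Env = ℕ → Type → PSet

ValidEnv : Env → Set
ValidEnv ε = ∀ i σ → IsElem (σ ↑) (ε i σ)

extend : Env → PSet → Env
extend ε d zero σ = d
extend ε d (suc i) σ = ε i σ

⟦_⟧ : Tm → Env → PSet
⟦ v i σ ⟧ ε = ε i σ
⟦ con c ⟧ ε = ⟦ c ⟧ᶜ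
⟦ lam σ M ⟧ ε = PrF (σ ↑) (λ d → ⟦ M ⟧ (extend ε d))
⟦ app M N ⟧ ε = apply (⟦ M ⟧ ε) (⟦ N ⟧ ε)

-- Each reduction rule then preserves type and meaning, and the theorem follows by
-- induction on the reduction sequence.
module Submission where

open import Defs
open import Data.Nat using (ℕ; zero; suc; pred; _<ᵇ_; _≡ᵇ_; _⊔_; _≤_; z≤n; s≤s)
open import Data.Nat.Properties using (m≤m⊔n; m≤n⊔m; suc-injective)
open import Data.Bool using (true; false; if_then_else_)
open import Data.Fin as Fin using (Fin; zero; suc)
open import Data.List using (List; []; _∷_; _++_; length; filter)
open import Data.List.Relation.Unary.All as All using (All; []; _∷_)
open import Data.List.Relation.Unary.All.Properties using (++⁺; all-filter; filter⁺; ¬Any⇒All¬)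
open import Data.List.Relation.Unary.Any as Any using (Any; here; there)
open import Data.List.Relation.Unary.Any.Properties using (++⁺ˡ; ++⁺ʳ; lookup-result)
  renaming (filter⁺ to Any-filter⁺)
open import Data.List.Relation.Unary.AllPairs using ([]; _∷_)
import Data.List.Relation.Unary.AllPairs.Properties as AllPairs
open import Data.Product using (∃; ∃₂; _×_; _,_; proj₁; proj₂)
open import Data.Sum using (_⊎_; inj₁; inj₂; [_,_])
open import Data.Empty using (⊥; ⊥-elim)
open import Data.Unit using (⊤; tt)
open import Function using (_∘_; id)
open import Relation.Nullary using (¬_; Dec; yes; no; ¬?)
open import Relation.Nullary.Decidable using (_×-dec_; _⊎-dec_; decidable-stable)
open import Relation.Binary.PropositionalEquality using (_≡_; refl; sym; trans; subst; cong)
open import Relation.Binary.Bundles using (Setoid)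
import Relation.Binary.Reasoning.Setoid as SetoidReasoning
import Level
open import Relation.Binary.Construct.Closure.ReflexiveTransitive as Star
  using (Star; _◅_; _◅◅_) renaming (ε to done)

Below-weaken : ∀ Y x X → Below Y X → Below Y (x ∷ X)
Below-weaken [] x X _ = tt
Below-weaken (y ∷ Y) x X (h , hs) = inj₂ h , Below-weaken Y x X hs

mutual
  ⊑-refl : ∀ p → p ⊑ p
  ⊑-refl (tag i) = refl
  ⊑-refl (inj i a) = refl , ⊑-refl a
  ⊑-refl (prj i a) = refl , ⊑-refl a
  ⊑-refl (fn X a) = Below-refl X , ⊑-refl a

  Below-refl : ∀ X → Below X X
  Below-refl [] = tt
  Below-refl (x ∷ X) = inj₁ (⊑-refl x) , Below-weaken X x X (Below-refl X)

mutual
  ⊑-trans : ∀ a b c → a ⊑ b → b ⊑ c → a ⊑ c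
  ⊑-trans (tag i) (tag j) (tag k) p q = trans p q
  ⊑-trans (tag i) (tag j) (inj k c) p q = trans p q
  ⊑-trans (tag i) (inj j b) (inj k c) p (q , _) = trans p q
  ⊑-trans (inj i a) (inj j b) (inj k c) (p , p') (q , q') = trans p q , ⊑-trans a b c p' q'
  ⊑-trans (prj i a) (prj j b) (prj k c) (p , p') (q , q') = trans p q , ⊑-trans a b c p' q'
  ⊑-trans (fn X a) (fn Y b) (fn Z c) (p , p') (q , q') = Below-trans Z Y X q p , ⊑-trans a b c p' q'

  Below-trans : ∀ Z Y X → Below Z Y → Below Y X → Below Z X
  Below-trans [] Y X _ _ = tt
  Below-trans (z ∷ Z) Y X (h , hs) k = SomeAbove-trans z Y X h k , Below-trans Z Y X hs k

  SomeAbove-trans : ∀ z Y X → SomeAbove z Y → Below Y X → SomeAbove z X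
  SomeAbove-trans z (y ∷ Y) X (inj₁ z⊑y) (k , _) = SomeAbove-lower z y X z⊑y k
  SomeAbove-trans z (y ∷ Y) X (inj₂ h) (_ , ks) = SomeAbove-trans z Y X h ks

  SomeAbove-lower : ∀ z y X → z ⊑ y → SomeAbove y X → SomeAbove z X
  SomeAbove-lower z y (x ∷ X) z⊑y (inj₁ y⊑x) = inj₁ (⊑-trans z y x z⊑y y⊑x)
  SomeAbove-lower z y (x ∷ X) z⊑y (inj₂ h) = inj₂ (SomeAbove-lower z y X z⊑y h)

-- ⊑ is decidable (needed to prune lists of primes to antichains).
mutual
  _⊑?_ : ∀ p q → Dec (p ⊑ q)
  tag i ⊑? tag j = i Fin.≟ j
  tag i ⊑? inj j b = i Fin.≟ j
  tag i ⊑? prj j b = no λ ()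
  tag i ⊑? fn Y b = no λ ()
  inj i a ⊑? tag j = no λ ()
  inj i a ⊑? inj j b = (i Fin.≟ j) ×-dec (a ⊑? b)
  inj i a ⊑? prj j b = no λ ()
  inj i a ⊑? fn Y b = no λ ()
  prj i a ⊑? tag j = no λ ()
  prj i a ⊑? inj j b = no λ ()
  prj i a ⊑? prj j b = (i Fin.≟ j) ×-dec (a ⊑? b)
  prj i a ⊑? fn Y b = no λ ()
  fn X a ⊑? tag j = no λ ()
  fn X a ⊑? inj j b = no λ ()
  fn X a ⊑? prj j b = no λ ()
  fn X a ⊑? fn Y b = Below? Y X ×-dec (a ⊑? b)

  Below? : ∀ Y X → Dec (Below Y X)
  Below? [] X = yes tt
  Below? (y ∷ Y) X = SomeAbove? y X ×-dec Below? Y X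

  SomeAbove? : ∀ y X → Dec (SomeAbove y X)
  SomeAbove? y [] = no λ ()
  SomeAbove? y (x ∷ X) = (y ⊑? x) ⊎-dec SomeAbove? y X

≍-refl : ∀ p → p ≍ p
≍-refl (tag i) = refl
≍-refl (inj i a) = refl , ≍-refl a
≍-refl (prj i a) = inj₂ (refl , ≍-refl a)
≍-refl (fn X a) = λ _ → ≍-refl a

AllCons-tail : ∀ Y x X → AllCons Y (x ∷ X) → AllCons Y X
AllCons-tail [] x X _ = tt
AllCons-tail (y ∷ Y) x X ((_ , c) , cs) = c , AllCons-tail Y x X cs

mutual
  ≍-sym : ∀ a b → a ≍ b → b ≍ a
  ≍-sym (tag i) (tag j) p = sym p
  ≍-sym (tag i) (inj j b) p = sym p
  ≍-sym (inj i a) (tag j) p = sym p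
  ≍-sym (inj i a) (inj j b) (p , q) = sym p , ≍-sym a b q
  ≍-sym (prj i a) (prj j b) (inj₁ p) = inj₁ (p ∘ sym)
  ≍-sym (prj i a) (prj j b) (inj₂ (p , q)) = inj₂ (sym p , ≍-sym a b q)
  ≍-sym (fn X a) (fn Y b) h = λ c → ≍-sym a b (h (AllCons-transpose Y X c))

  AllCons-transpose : ∀ Y X → AllCons Y X → AllCons X Y
  AllCons-transpose Y [] _ = tt
  AllCons-transpose Y (x ∷ X) c = AllCons-column Y x X c , AllCons-transpose Y X (AllCons-tail Y x X c)

  AllCons-column : ∀ Y x X → AllCons Y (x ∷ X) → ConsWith x Y
  AllCons-column [] x X _ = tt
  AllCons-column (y ∷ Y) x X ((y≍x , _) , cs) = ≍-sym y x y≍x , AllCons-column Y x X cs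

mutual
  ≍-downʳ : ∀ a b c → a ≍ b → c ⊑ b → a ≍ c
  ≍-downʳ (tag i) (tag j) (tag k) h le = trans h (sym le)
  ≍-downʳ (inj i a) (tag j) (tag k) h le = trans h (sym le)
  ≍-downʳ (tag i) (inj j b) (tag k) h le = trans h (sym le)
  ≍-downʳ (tag i) (inj j b) (inj k c) h (le , _) = trans h (sym le)
  ≍-downʳ (inj i a) (inj j b) (tag k) (h , _) le = trans h (sym le)
  ≍-downʳ (inj i a) (inj j b) (inj k c) (h , h') (le , le') = trans h (sym le) , ≍-downʳ a b c h' le'
  ≍-downʳ (prj i a) (prj j b) (prj k c) (inj₁ h) (le , _) = inj₁ (λ e → h (trans e le))
  ≍-downʳ (prj i a) (prj j b) (prj k c) (inj₂ (h , h')) (le , le') = inj₂ (trans h (sym le) , ≍-downʳ a b c h' le')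
  ≍-downʳ (fn X a) (fn Y b) (fn Z c) h (Z≤Y , le') = λ cXZ → ≍-downʳ a b c (h (AllCons-up X Y Z cXZ Z≤Y)) le'

  AllCons-up : ∀ X Y Z → AllCons X Z → Below Y Z → AllCons X Y
  AllCons-up [] Y Z _ _ = tt
  AllCons-up (x ∷ X) Y Z (cx , cs) Y≤Z = ConsWith-up x Y Z cx Y≤Z , AllCons-up X Y Z cs Y≤Z

  ConsWith-up : ∀ x Y Z → ConsWith x Z → Below Y Z → ConsWith x Y
  ConsWith-up x [] Z _ _ = tt
  ConsWith-up x (y ∷ Y) Z cx (y≤Z , Y≤Z) = ConsWith-above x y Z cx y≤Z , ConsWith-up x Y Z cx Y≤Z

  ConsWith-above : ∀ x y Z → ConsWith x Z → SomeAbove y Z → x ≍ y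
  ConsWith-above x y (z ∷ Z) (x≍z , _) (inj₁ y⊑z) = ≍-downʳ x z y x≍z y⊑z
  ConsWith-above x y (z ∷ Z) (_ , cx) (inj₂ y≤Z) = ConsWith-above x y Z cx y≤Z

≍-downˡ : ∀ a b c → a ≍ b → c ⊑ a → c ≍ b
≍-downˡ a b c h le = ≍-sym b c (≍-downʳ b a c (≍-sym a b h) le)

_⊆↓_ : List Prime → List Prime → Set
Y ⊆↓ X = ∀ q → Any (q ⊑_) Y → Any (q ⊑_) X

SomeAbove⇒Any : ∀ y X → SomeAbove y X → Any (y ⊑_) X
SomeAbove⇒Any y (x ∷ X) (inj₁ h) = here h
SomeAbove⇒Any y (x ∷ X) (inj₂ h) = there (SomeAbove⇒Any y X h)

Any⇒SomeAbove : ∀ y X → Any (y ⊑_) X → SomeAbove y X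
Any⇒SomeAbove y (x ∷ X) (here h) = inj₁ h
Any⇒SomeAbove y (x ∷ X) (there h) = inj₂ (Any⇒SomeAbove y X h)

Any-lower : ∀ q p Z → q ⊑ p → Any (p ⊑_) Z → Any (q ⊑_) Z
Any-lower q p Z q⊑p = Any.map (λ {z} → ⊑-trans q p z q⊑p)

Below⇒⊆↓ : ∀ Y X → Below Y X → Y ⊆↓ X
Below⇒⊆↓ (y ∷ Y) X (y≤X , _) q (here q⊑y) = SomeAbove⇒Any q X (SomeAbove-lower q y X q⊑y y≤X)
Below⇒⊆↓ (y ∷ Y) X (_ , Y≤X) q (there h) = Below⇒⊆↓ Y X Y≤X q h

⊆↓⇒Below : ∀ Y X → Y ⊆↓ X → Below Y X
⊆↓⇒Below [] X _ = tt
⊆↓⇒Below (y ∷ Y) X h = Any⇒SomeAbove y X (h y (here (⊑-refl y))) , ⊆↓⇒Below Y X (λ q → h q ∘ there)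

Cross : (Prime → Prime → Set) → List Prime → List Prime → Set
Cross R X Y = All (λ x → All (R x) Y) X

Consistent : List Prime → Set
Consistent X = Cross _≍_ X X

cross : ∀ {P Q : Prime → Set} {R} {X Y} → (∀ x y → P x → Q y → R x y) → All P X → All Q Y → Cross R X Y
cross f PX QY = All.map (λ {x} px → All.map (λ {y} qy → f x y px qy) QY) PX

Cross⇒AllCons : ∀ X Y → Cross _≍_ X Y → AllCons X Y
Cross⇒AllCons [] Y [] = tt
Cross⇒AllCons (x ∷ X) Y (cx ∷ cs) = row Y cx , Cross⇒AllCons X Y cs
  where row : ∀ Y → All (x ≍_) Y → ConsWith x Y
        row [] [] = tt
        row (y ∷ Y) (c ∷ cs) = c , row Y cs

AllCons⇒Cross : ∀ X Y → AllCons X Y → Cross _≍_ X Y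
AllCons⇒Cross [] Y _ = []
AllCons⇒Cross (x ∷ X) Y (cx , cs) = row Y cx ∷ AllCons⇒Cross X Y cs
  where row : ∀ Y → ConsWith x Y → All (x ≍_) Y
        row [] _ = []
        row (y ∷ Y) (c , cs) = c ∷ row Y cs

Cross-transpose : ∀ X Y → Cross _≍_ X Y → Cross _≍_ Y X
Cross-transpose X Y c =
  All.tabulate λ {y} y∈Y → All.tabulate λ {x} x∈X → ≍-sym x y (All.lookup (All.lookup c x∈X) y∈Y)

Indep⇒Consistent : ∀ X → Indep X → Consistent X
Indep⇒Consistent [] [] = []
Indep⇒Consistent (x ∷ X) (hx ∷ hs) =
  (≍-refl x ∷ x≍X) ∷ All.zipWith (λ (c , cs) → c ∷ cs)
                       (All.map (λ {y} → ≍-sym x y) x≍X , Indep⇒Consistent X hs)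
  where x≍X : All (x ≍_) X
        x≍X = All.map proj₁ hx

Consistent-++ : ∀ X Y → Consistent X → Consistent Y → Cross _≍_ X Y → Consistent (X ++ Y)
Consistent-++ X Y cX cY cXY =
  ++⁺ (All.zipWith (λ (a , b) → ++⁺ a b) (cX , cXY))
      (All.zipWith (λ (a , b) → ++⁺ a b) (Cross-transpose X Y cXY , cY))

-- Any finite list of primes drawn from a consistent set d is covered by an
-- antichain drawn from d; this is what makes every prime of PrF f witnessable
-- by an independent finite set, as required in the β-law below.
module Antichain (d : PSet) (d-cons : ∀ p q → d p → d q → p ≍ q) where

  prune : Prime → List Prime → List Prime
  prune p = filter (λ z → ¬? (z ⊑? p))

  prune-covers : ∀ p Z q → Any (q ⊑_) Z → q ⊑ p ⊎ Any (q ⊑_) (prune p Z)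
  prune-covers p Z q q≤Z with Any-filter⁺ (λ z → ¬? (z ⊑? p)) q≤Z
  ... | inj₁ h = inj₂ h
  ... | inj₂ ¬¬z⊑p = inj₁ (⊑-trans q _ p (lookup-result q≤Z) (decidable-stable (_ ⊑? p) ¬¬z⊑p))

  insert : ∀ p Z → d p → All d Z → Indep Z → ∃ λ Z' → All d Z' × Indep Z' × (p ∷ Z) ⊆↓ Z'
  insert p Z dp dZ iZ with Any.any? (p ⊑?_) Z
  ... | yes p≤Z = Z , dZ , iZ , cover
    where cover : (p ∷ Z) ⊆↓ Z
          cover q (here q⊑p) = Any-lower q p Z q⊑p p≤Z
          cover q (there h) = h
  ... | no p≰Z = p ∷ prune p Z , dp ∷ filter⁺ _ dZ , head ∷ AllPairs.filter⁺ _ iZ , cover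
    where
      head : All (λ z → p ≍ z × ¬ p ⊑ z × ¬ z ⊑ p) (prune p Z)
      head = All.zipWith (λ ((p≍z , p⋢z) , z⋢p) → p≍z , p⋢z , z⋢p)
               ( filter⁺ _ (All.zipWith (λ { {z} (dz , p⋢z) → d-cons p z dp dz , p⋢z })
                                        (dZ , ¬Any⇒All¬ Z p≰Z))
               , all-filter _ Z)
      cover : (p ∷ Z) ⊆↓ (p ∷ prune p Z)
      cover q (here q⊑p) = here q⊑p
      cover q (there h) with prune-covers p Z q h
      ... | inj₁ q⊑p = here q⊑p
      ... | inj₂ h' = there h'

  antichain : ∀ L → All d L → ∃ λ Z → All d Z × Indep Z × L ⊆↓ Z
  antichain [] _ = [] , [] , [] , λ q ()
  antichain (p ∷ L) (dp ∷ dL) with antichain L dL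
  ... | Z , dZ , iZ , L⊆Z with insert p Z dp dZ iZ
  ... | Z' , dZ' , iZ' , pZ⊆Z' = Z' , dZ' , iZ' , cover
    where cover : (p ∷ L) ⊆↓ Z'
          cover q (here q⊑p) = pZ⊆Z' q (here q⊑p)
          cover q (there h) = pZ⊆Z' q (there (L⊆Z q h))

data Op : Set where
  sum prod fun : Op

_⟨_⟩_ : Type → Op → Type → Type
σ ⟨ sum ⟩ τ = σ ⊕ τ
σ ⟨ prod ⟩ τ = σ ⊗ τ
σ ⟨ fun ⟩ τ = σ ⇒ τ

_⟨_⟩ˢ_ : STy → Op → STy → STy
s ⟨ sum ⟩ˢ t = s ⊕ˢ t
s ⟨ prod ⟩ˢ t = s ⊗ˢ t
s ⟨ fun ⟩ˢ t = s ⇒ˢ t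

sel : ∀ {a} {A : Set a} → Fin 2 → A → A → A
sel zero x y = x
sel (suc zero) x y = y

sel-elim : ∀ {a p} {A : Set a} (P : A → Set p) i {x y} → P x → P y → P (sel i x y)
sel-elim P zero px py = px
sel-elim P (suc zero) px py = py

sel-natural : ∀ {a b} {A : Set a} {B : Set b} (f : A → B) i x y → f (sel i x y) ≡ sel i (f x) (f y)
sel-natural f zero x y = refl
sel-natural f (suc zero) x y = refl

▷-split : ∀ o {σ τ ρ} → (σ ⟨ o ⟩ τ) ▷ ρ →
          (∃ λ σ' → ρ ≡ σ' ⟨ o ⟩ τ × σ ▷ σ') ⊎ (∃ λ τ' → ρ ≡ σ ⟨ o ⟩ τ' × τ ▷ τ')
▷-split sum (⊕ˡ s) = inj₁ (_ , refl , s)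
▷-split sum (⊕ʳ s) = inj₂ (_ , refl , s)
▷-split prod (⊗ˡ s) = inj₁ (_ , refl , s)
▷-split prod (⊗ʳ s) = inj₂ (_ , refl , s)
▷-split fun (⇒ˡ s) = inj₁ (_ , refl , s)
▷-split fun (⇒ʳ s) = inj₂ (_ , refl , s)

▷*-split : ∀ o {σ τ ρ} → Star _▷_ (σ ⟨ o ⟩ τ) ρ →
           ∃₂ λ σ' τ' → ρ ≡ σ' ⟨ o ⟩ τ' × Star _▷_ σ σ' × Star _▷_ τ τ'
▷*-split o done = _ , _ , refl , done , done
▷*-split o (s ◅ r) with ▷-split o s
... | inj₁ (_ , refl , s') = let σ' , τ' , eq , r₁ , r₂ = ▷*-split o r in σ' , τ' , eq , s' ◅ r₁ , r₂
... | inj₂ (_ , refl , s') = let σ' , τ' , eq , r₁ , r₂ = ▷*-split o r in σ' , τ' , eq , r₁ , s' ◅ r₂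

▷-congˡ : ∀ o {σ σ' τ} → σ ▷ σ' → (σ ⟨ o ⟩ τ) ▷ (σ' ⟨ o ⟩ τ)
▷-congˡ sum = ⊕ˡ
▷-congˡ prod = ⊗ˡ
▷-congˡ fun = ⇒ˡ

▷-congʳ : ∀ o {σ τ τ'} → τ ▷ τ' → (σ ⟨ o ⟩ τ) ▷ (σ ⟨ o ⟩ τ')
▷-congʳ sum = ⊕ʳ
▷-congʳ prod = ⊗ʳ
▷-congʳ fun = ⇒ʳ

▷*-cong : ∀ o {σ σ' τ τ'} → Star _▷_ σ σ' → Star _▷_ τ τ' → Star _▷_ (σ ⟨ o ⟩ τ) (σ' ⟨ o ⟩ τ')
▷*-cong o {σ' = σ'} {τ = τ} r₁ r₂ =
  Star.gmap (λ σ → σ ⟨ o ⟩ τ) (▷-congˡ o) r₁ ◅◅ Star.gmap (λ τ → σ' ⟨ o ⟩ τ) (▷-congʳ o) r₂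

⪯-split : ∀ o {s t σ τ} → (s ⟨ o ⟩ˢ t) ⪯ (σ ⟨ o ⟩ τ) → s ⪯ σ × t ⪯ τ
⪯-split sum (⊕⪯ a b) = a , b
⪯-split prod (⊗⪯ a b) = a , b
⪯-split fun (⇒⪯ a b) = a , b

⪯-join : ∀ o {s t σ τ} → s ⪯ σ → t ⪯ τ → (s ⟨ o ⟩ˢ t) ⪯ (σ ⟨ o ⟩ τ)
⪯-join sum = ⊕⪯
⪯-join prod = ⊗⪯
⪯-join fun = ⇒⪯

void↑ : ∀ σ → (σ ↑) svoid
void↑ σ = σ , done , void⪯

↑-split : ∀ o {σ τ s t} → ((σ ⟨ o ⟩ τ) ↑) (s ⟨ o ⟩ˢ t) → (σ ↑) s × (τ ↑) t
↑-split o (ρ , r , le) with ▷*-split o r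
... | σ' , τ' , refl , r₁ , r₂ = let a , b = ⪯-split o le in (σ' , r₁ , a) , (τ' , r₂ , b)

↑-join : ∀ o {σ τ s t} → (σ ↑) s → (τ ↑) t → ((σ ⟨ o ⟩ τ) ↑) (s ⟨ o ⟩ˢ t)
↑-join o (σ' , r₁ , a) (τ' , r₂ , b) = σ' ⟨ o ⟩ τ' , ▷*-cong o r₁ r₂ , ⪯-join o a b

↑-sum-shape : ∀ {σ τ} s o t → ((σ ⊕ τ) ↑) (s ⟨ o ⟩ˢ t) → o ≡ sum
↑-sum-shape s sum t _ = refl
↑-sum-shape s prod t (ρ , r , le) with ▷*-split sum r
↑-sum-shape s prod t (_ , r , ()) | _ , _ , refl , _ , _
↑-sum-shape s fun t (ρ , r , le) with ▷*-split sum r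
↑-sum-shape s fun t (_ , r , ()) | _ , _ , refl , _ , _

_≡T_ : TypeTree → TypeTree → Set
T ≡T U = ∀ s → (T s → U s) × (U s → T s)

_⊆T_ : TypeTree → TypeTree → Set
T ⊆T U = ∀ s → T s → U s

≡T-sym : ∀ {T U} → T ≡T U → U ≡T T
≡T-sym h s = proj₂ (h s) , proj₁ (h s)

≡T-trans : ∀ {T U V} → T ≡T U → U ≡T V → T ≡T V
≡T-trans h k s = proj₁ (k s) ∘ proj₁ (h s) , proj₂ (h s) ∘ proj₂ (k s)

⊆T-of : ∀ {T U} → T ≡T U → T ⊆T U
⊆T-of h s = proj₁ (h s)

≈-refl : ∀ {σ} → σ ≈ σ
≈-refl s = (λ x → x) , (λ x → x)

≈-sym : ∀ {σ τ} → σ ≈ τ → τ ≈ σ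
≈-sym = ≡T-sym

≈-trans : ∀ {σ τ ρ} → σ ≈ τ → τ ≈ ρ → σ ≈ ρ
≈-trans = ≡T-trans

Shaped : Op → TypeTree → Set
Shaped o T = ∃₂ λ s t → T (s ⟨ o ⟩ˢ t)

comp : Op → Fin 2 → TypeTree → TypeTree
comp sum i = sumComp i
comp prod i = prodComp i
comp fun zero = funDom
comp fun (suc zero) = funCod

Shaped-mono : ∀ o {T U} → T ⊆T U → Shaped o T → Shaped o U
Shaped-mono o h (s , t , x) = s , t , h _ x

comp-mono : ∀ o i {T U} → T ⊆T U → comp o i T ⊆T comp o i U
comp-mono sum zero h _ (t , x) = t , h _ x
comp-mono sum (suc zero) h _ (t , x) = t , h _ x
comp-mono prod zero h _ (t , x) = t , h _ x
comp-mono prod (suc zero) h _ (t , x) = t , h _ x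
comp-mono fun zero h _ (t , x) = t , h _ x
comp-mono fun (suc zero) h _ (t , x) = t , h _ x

Shaped↑ : ∀ o σ τ → Shaped o ((σ ⟨ o ⟩ τ) ↑)
Shaped↑ o σ τ = svoid , svoid , ↑-join o (void↑ σ) (void↑ τ)

left↑ : ∀ o σ τ → (λ s → ∃ λ t → ((σ ⟨ o ⟩ τ) ↑) (s ⟨ o ⟩ˢ t)) ≡T (σ ↑)
left↑ o σ τ s = (λ (t , x) → proj₁ (↑-split o x)) , (λ x → svoid , ↑-join o x (void↑ τ))

right↑ : ∀ o σ τ → (λ t → ∃ λ s → ((σ ⟨ o ⟩ τ) ↑) (s ⟨ o ⟩ˢ t)) ≡T (τ ↑)
right↑ o σ τ t = (λ (s , x) → proj₂ (↑-split o x)) , (λ x → svoid , ↑-join o (void↑ σ) x)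

comp↑ : ∀ o i σ τ → comp o i ((σ ⟨ o ⟩ τ) ↑) ≡T (sel i σ τ ↑)
comp↑ sum zero = left↑ sum
comp↑ sum (suc zero) = right↑ sum
comp↑ prod zero = left↑ prod
comp↑ prod (suc zero) = right↑ prod
comp↑ fun zero = left↑ fun
comp↑ fun (suc zero) = right↑ fun

≈-comp : ∀ o i {σ τ σ' τ'} → (σ ⟨ o ⟩ τ) ≈ (σ' ⟨ o ⟩ τ') → sel i σ τ ≈ sel i σ' τ'
≈-comp o i {σ} {τ} {σ'} {τ'} h s =
  (λ x → proj₁ (comp↑ o i σ' τ' s) (comp-mono o i (⊆T-of h) s (proj₂ (comp↑ o i σ τ s) x))) ,
  (λ x → proj₁ (comp↑ o i σ τ s) (comp-mono o i (⊆T-of (≡T-sym h)) s (proj₂ (comp↑ o i σ' τ' s) x)))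

Pn-mono : ∀ {m n} → m ≤ n → ∀ T p → Pn m T p → Pn n T p
Pn-mono {suc m} {suc n} (s≤s le) T (tag i) x = x
Pn-mono {suc m} {suc n} (s≤s le) T (inj i a) (x , q) = x , Pn-mono le _ a q
Pn-mono {suc m} {suc n} (s≤s le) T (prj i a) (x , q) = x , Pn-mono le _ a q
Pn-mono {suc m} {suc n} (s≤s le) T (fn X a) (x , qs , ind , q) =
  x , All.map (Pn-mono le _ _) qs , ind , Pn-mono le _ a q

Pn-monoT : ∀ n {T U} → T ⊆T U → ∀ p → Pn n T p → Pn n U p
Pn-monoT (suc n) h (tag i) x = Shaped-mono sum h x
Pn-monoT (suc n) h (inj i a) (x , q) = Shaped-mono sum h x , Pn-monoT n (comp-mono sum i h) a q
Pn-monoT (suc n) h (prj i a) (x , q) = Shaped-mono prod h x , Pn-monoT n (comp-mono prod i h) a q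
Pn-monoT (suc n) h (fn X a) (x , qs , ind , q) =
  Shaped-mono fun h x , All.map (Pn-monoT n (comp-mono fun zero h) _) qs , ind ,
  Pn-monoT n (comp-mono fun (suc zero) h) a q

PP-monoT : ∀ {T U} → T ⊆T U → ∀ p → PP T p → PP U p
PP-monoT h p (n , q) = n , Pn-monoT n h p q

PP-level : ∀ T X → All (PP T) X → ∃ λ n → All (Pn n T) X
PP-level T [] [] = 0 , []
PP-level T (x ∷ X) ((m , q) ∷ qs) =
  let n , rs = PP-level T X qs
  in m ⊔ n , Pn-mono (m≤m⊔n m n) T x q ∷ All.map (Pn-mono (m≤n⊔m m n) T _) rs

PP-tag : ∀ σ τ i → PP ((σ ⊕ τ) ↑) (tag i)
PP-tag σ τ i = 1 , Shaped↑ sum σ τ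

PP-inj⁻ : ∀ σ τ i a → PP ((σ ⊕ τ) ↑) (inj i a) → PP (sel i σ τ ↑) a
PP-inj⁻ σ τ i a (suc n , _ , q) = n , Pn-monoT n (⊆T-of (comp↑ sum i σ τ)) a q

PP-inj⁺ : ∀ σ τ i a → PP (sel i σ τ ↑) a → PP ((σ ⊕ τ) ↑) (inj i a)
PP-inj⁺ σ τ i a (n , q) = suc n , Shaped↑ sum σ τ , Pn-monoT n (⊆T-of (≡T-sym (comp↑ sum i σ τ))) a q

PP-prj⁻ : ∀ σ τ i a → PP ((σ ⊗ τ) ↑) (prj i a) → PP (sel i σ τ ↑) a
PP-prj⁻ σ τ i a (suc n , _ , q) = n , Pn-monoT n (⊆T-of (comp↑ prod i σ τ)) a q

PP-prj⁺ : ∀ σ τ i a → PP (sel i σ τ ↑) a → PP ((σ ⊗ τ) ↑) (prj i a)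
PP-prj⁺ σ τ i a (n , q) = suc n , Shaped↑ prod σ τ , Pn-monoT n (⊆T-of (≡T-sym (comp↑ prod i σ τ))) a q

PP-fn⁻ : ∀ σ τ X a → PP ((σ ⇒ τ) ↑) (fn X a) → All (PP (σ ↑)) X × Indep X × PP (τ ↑) a
PP-fn⁻ σ τ X a (suc n , _ , qs , ind , q) =
  All.map (λ r → n , Pn-monoT n (⊆T-of (comp↑ fun zero σ τ)) _ r) qs , ind ,
  (n , Pn-monoT n (⊆T-of (comp↑ fun (suc zero) σ τ)) a q)

PP-fn⁺ : ∀ σ τ X a → All (PP (σ ↑)) X → Indep X → PP (τ ↑) a → PP ((σ ⇒ τ) ↑) (fn X a)
PP-fn⁺ σ τ X a qs ind (m , q) =
  let n , rs = PP-level _ X qs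
  in suc (m ⊔ n) , Shaped↑ fun σ τ ,
     All.map (λ r → Pn-monoT (m ⊔ n) (⊆T-of (≡T-sym (comp↑ fun zero σ τ))) _ (Pn-mono (m≤n⊔m m n) _ _ r)) rs ,
     ind , Pn-monoT (m ⊔ n) (⊆T-of (≡T-sym (comp↑ fun (suc zero) σ τ))) a (Pn-mono (m≤m⊔n m n) _ a q)

PP-sum-tag : ∀ σ τ p → PP ((σ ⊕ τ) ↑) p → ∃ λ i → tag i ⊑ p
PP-sum-tag σ τ (tag i) _ = i , refl
PP-sum-tag σ τ (inj i a) _ = i , refl
PP-sum-tag σ τ (prj i a) (suc n , (s , t , x) , _) with ↑-sum-shape s prod t x
... | ()
PP-sum-tag σ τ (fn X a) (suc n , (s , t , x) , _) with ↑-sum-shape s fun t x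
... | ()

infix 4 _⊆_
_⊆_ : PSet → PSet → Set
d ⊆ e = ∀ p → d p → e p

⊆-refl : ∀ {d} → d ⊆ d
⊆-refl p x = x

≐-refl : ∀ {d} → d ≐ d
≐-refl p = (λ x → x) , (λ x → x)

≐-sym : ∀ {d e} → d ≐ e → e ≐ d
≐-sym h p = proj₂ (h p) , proj₁ (h p)

≐-trans : ∀ {d e f} → d ≐ e → e ≐ f → d ≐ f
≐-trans h k p = proj₁ (k p) ∘ proj₁ (h p) , proj₂ (h p) ∘ proj₂ (k p)

≐-setoid : Setoid (Level.suc Level.zero) Level.zero
≐-setoid = record { Carrier = PSet ; _≈_ = _≐_
                  ; isEquivalence = record { refl = ≐-refl ; sym = ≐-sym ; trans = ≐-trans } }

module ≐-Reasoning = SetoidReasoning ≐-setoid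

⊆-of : ∀ {d e} → d ≐ e → d ⊆ e
⊆-of h p = proj₁ (h p)

elem-PP : ∀ {T d} → IsElem T d → ∀ p → d p → PP T p
elem-PP (pp , _ , _) = pp

elem-down : ∀ {T d} → IsElem T d → ∀ p q → d q → PP T p → p ⊑ q → d p
elem-down (_ , dc , _) = dc

elem-cons : ∀ {T d} → IsElem T d → ∀ p q → d p → d q → p ≍ q
elem-cons (_ , _ , cons) = cons

elem-tree : ∀ {T U d} → T ≡T U → IsElem T d → IsElem U d
elem-tree h e =
  (λ p x → PP-monoT (⊆T-of h) p (elem-PP e p x)) ,
  (λ p q x pp → elem-down e p q x (PP-monoT (⊆T-of (≡T-sym h)) p pp)) ,
  elem-cons e

∅-elem : ∀ T → IsElem T (λ _ → ⊥)
∅-elem T = (λ p ()) , (λ p q ()) , (λ p q ())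

down-mono : ∀ T {X Y} → X ⊆↓ Y → down T X ⊆ down T Y
down-mono T h q (pq , a) = pq , h q a

down-elem : ∀ T X → All (PP T) X → Consistent X → IsElem T (down T X)
down-elem T X ppX cX = (λ p → proj₁) , (λ p q (_ , q≤X) pp p⊑q → pp , Any-lower p q X p⊑q q≤X) , cons
  where
    cons : ∀ p q → down T X p → down T X q → p ≍ q
    cons p q (_ , p≤X) (_ , q≤X) =
      let x≍X , p⊑x = All.lookupAny cX p≤X
          x≍y , q⊑y = All.lookupAny x≍X q≤X
      in ≍-downˡ _ q p (≍-downʳ _ _ q x≍y q⊑y) p⊑x

down⊆ : ∀ {T d} X → IsElem T d → All d X → down T X ⊆ d
down⊆ X e dX q (pq , q≤X) = let dx , q⊑x = All.lookupAny dX q≤X in elem-down e q _ dx pq q⊑x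

FinElem : TypeTree → List Prime → Set
FinElem T X = All (PP T) X × Consistent X

FinElem-elem : ∀ T X → FinElem T X → IsElem T (down T X)
FinElem-elem T X (ppX , cX) = down-elem T X ppX cX

antichain-FinElem : ∀ T X → All (PP T) X → Indep X → FinElem T X
antichain-FinElem T X ppX iX = ppX , Indep⇒Consistent X iX

Monotone : (PSet → PSet) → Set₁
Monotone f = ∀ {e e'} → e ⊆ e' → f e ⊆ f e'

apply-mono : ∀ {r r' d d'} → r ⊆ r' → d ⊆ d' → apply r d ⊆ apply r' d'
apply-mono hr hd a (X , dX , rX) = X , All.map (hd _) dX , hr _ rX

-- PrF T f only depends on f at the finite elements ↓X of P(T)
PrF-mono : ∀ T f g → (∀ X → FinElem T X → f (down T X) ⊆ g (down T X)) → PrF T f ⊆ PrF T g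
PrF-mono T f g h (fn X a) (pp , ind , fa) = pp , ind , h X (antichain-FinElem T X pp ind) a fa

apply-resp : ∀ {r r' d d'} → r ≐ r' → d ≐ d' → apply r d ≐ apply r' d'
apply-resp hr hd a = apply-mono (⊆-of hr) (⊆-of hd) a , apply-mono (⊆-of (≐-sym hr)) (⊆-of (≐-sym hd)) a

PrF-resp : ∀ T f g → (∀ X → FinElem T X → f (down T X) ≐ g (down T X)) → PrF T f ≐ PrF T g
PrF-resp T f g h p = PrF-mono T f g (λ X fX → ⊆-of (h X fX)) p ,
                     PrF-mono T g f (λ X fX → ⊆-of (≐-sym (h X fX))) p

EnvSub : Env → Env → Set
EnvSub ε ε' = ∀ i σ → ε i σ ⊆ ε' i σ

EnvEq : Env → Env → Set
EnvEq ε ε' = ∀ i σ → ε i σ ≐ ε' i σ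

extend-mono : ∀ {ε ε' d d'} → EnvSub ε ε' → d ⊆ d' → EnvSub (extend ε d) (extend ε' d')
extend-mono h hd zero σ = hd
extend-mono h hd (suc i) σ = h i σ

sem-mono : ∀ M {ε ε'} → EnvSub ε ε' → ⟦ M ⟧ ε ⊆ ⟦ M ⟧ ε'
sem-mono (v i σ) h = h i σ
sem-mono (con c) h = ⊆-refl
sem-mono (lam σ M) h = PrF-mono (σ ↑) _ _ λ X _ → sem-mono M (extend-mono h ⊆-refl)
sem-mono (app M N) h = apply-mono (sem-mono M h) (sem-mono N h)

sem-resp : ∀ M {ε ε'} → EnvEq ε ε' → ⟦ M ⟧ ε ≐ ⟦ M ⟧ ε'
sem-resp M h p = sem-mono M (λ i σ → ⊆-of (h i σ)) p , sem-mono M (λ i σ → ⊆-of (≐-sym (h i σ))) p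

Cont : TypeTree → PSet → (PSet → PSet) → Set
Cont T d f = ∀ a → f d a → ∃ λ L → All d L × f (down T L) a

Cont-const : ∀ T d c → Cont T d (λ _ → c)
Cont-const T d c a x = [] , [] , x

Cont-id : ∀ T d → (∀ p → d p → PP T p) → Cont T d (λ e → e)
Cont-id T d pp a x = a ∷ [] , x ∷ [] , pp a x , here (⊑-refl a)

down-++ˡ : ∀ T L L' → down T L ⊆ down T (L ++ L')
down-++ˡ T L L' = down-mono T (λ q → ++⁺ˡ)

down-++ʳ : ∀ T L L' → down T L' ⊆ down T (L ++ L')
down-++ʳ T L L' = down-mono T (λ q → ++⁺ʳ L)

Cont-list : ∀ T d G → Monotone G → Cont T d G → ∀ X → All (G d) X → ∃ λ L → All d L × All (G (down T L)) X
Cont-list T d G G-mono G-cont [] [] = [] , [] , []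
Cont-list T d G G-mono G-cont (x ∷ X) (gx ∷ gX) =
  let L₁ , dL₁ , g₁ = G-cont x gx
      L₂ , dL₂ , g₂ = Cont-list T d G G-mono G-cont X gX
  in L₁ ++ L₂ , ++⁺ dL₁ dL₂ , G-mono (down-++ˡ T L₁ L₂) x g₁ ∷ All.map (G-mono (down-++ʳ T L₁ L₂) _) g₂

Cont-apply : ∀ T d {R G} → Monotone R → Monotone G → Cont T d R → Cont T d G →
             Cont T d (λ e → apply (R e) (G e))
Cont-apply T d {R} {G} R-mono G-mono R-cont G-cont a (X , gX , rX) =
  let L₁ , dL₁ , r' = R-cont (fn X a) rX
      L₂ , dL₂ , g' = Cont-list T d G G-mono G-cont X gX
  in L₁ ++ L₂ , ++⁺ dL₁ dL₂ , X , All.map (G-mono (down-++ʳ T L₁ L₂) _) g' , R-mono (down-++ˡ T L₁ L₂) _ r'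

-- The semantics of a term is continuous in a monotone, continuously varying
-- environment F e.  (For the β-law F e is ε extended by e.)
sem-cont : ∀ M T d (F : PSet → Env) → (∀ {e e'} → e ⊆ e' → EnvSub (F e) (F e')) →
           (∀ i σ → Cont T d (λ e → F e i σ)) → Cont T d (λ e → ⟦ M ⟧ (F e))
sem-cont (v i σ) T d F F-mono F-cont = F-cont i σ
sem-cont (con c) T d F F-mono F-cont = Cont-const T d _
sem-cont (lam σ M) T d F F-mono F-cont (fn X b) (ppX , ind , x) =
  let L , dL , y = sem-cont M T d (λ e → extend (F e) (down (σ ↑) X))
                     (λ h → extend-mono (F-mono h) ⊆-refl) F'-cont b x
  in L , dL , ppX , ind , y
  where F'-cont : ∀ i τ → Cont T d (λ e → extend (F e) (down (σ ↑) X) i τ)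
        F'-cont zero τ = Cont-const T d _
        F'-cont (suc i) τ = F-cont i τ
sem-cont (app M N) T d F F-mono F-cont =
  Cont-apply T d (λ h → sem-mono M (F-mono h)) (λ h → sem-mono N (F-mono h))
                 (sem-cont M T d F F-mono F-cont) (sem-cont N T d F F-mono F-cont)

-- The β-law for PrF: applying Pr(f) to an element d gives f d, provided f is
-- monotone and continuous at d.  Finite parts of d are replaced by antichains.
beta : ∀ T f d → IsElem T d → Monotone f → Cont T d f → apply (PrF T f) d ≐ f d
beta T f d e f-mono f-cont a = to , from
  where
    open Antichain d (elem-cons e)
    to : apply (PrF T f) d a → f d a
    to (X , dX , _ , _ , fa) = f-mono (down⊆ X e dX) a fa
    from : f d a → apply (PrF T f) d a
    from x = let L , dL , y = f-cont a x
                 Z , dZ , iZ , L⊆Z = antichain L dL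
             in Z , dZ , All.map (elem-PP e _) dZ , iZ , f-mono (down-mono T L⊆Z) a y

beta-lam : ∀ σ M ε d → IsElem (σ ↑) d → apply (⟦ lam σ M ⟧ ε) d ≐ ⟦ M ⟧ (extend ε d)
beta-lam σ M ε d e =
  beta (σ ↑) (λ d' → ⟦ M ⟧ (extend ε d')) d e (sem-mono M ∘ extend-ε)
       (sem-cont M (σ ↑) d (extend ε) extend-ε var-cont)
  where
    extend-ε : ∀ {e e'} → e ⊆ e' → EnvSub (extend ε e) (extend ε e')
    extend-ε = extend-mono (λ _ _ → ⊆-refl)
    var-cont : ∀ i τ → Cont (σ ↑) d (λ d' → extend ε d' i τ)
    var-cont zero τ = Cont-id (σ ↑) d (elem-PP e)
    var-cont (suc i) τ = Cont-const (σ ↑) d _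

record ElemFun (T U : TypeTree) (f : PSet → PSet) : Set₁ where
  field
    preserves : ∀ d → IsElem T d → IsElem U (f d)
    monotone : ∀ X Y → FinElem T X → FinElem T Y → down T X ⊆ down T Y → f (down T X) ⊆ f (down T Y)
open ElemFun

PrF-elem : ∀ σ τ f → ElemFun (σ ↑) (τ ↑) f → IsElem ((σ ⇒ τ) ↑) (PrF (σ ↑) f)
PrF-elem σ τ f F = pp , dc , cons
  where
    ↓ : List Prime → PSet
    ↓ = down (σ ↑)
    f↓-elem : ∀ X → FinElem (σ ↑) X → IsElem (τ ↑) (f (↓ X))
    f↓-elem X fX = preserves F _ (FinElem-elem _ X fX)
    pp : ∀ p → PrF (σ ↑) f p → PP ((σ ⇒ τ) ↑) p
    pp (fn X a) (ppX , iX , fa) = PP-fn⁺ σ τ X a ppX iX (elem-PP (f↓-elem X (antichain-FinElem _ X ppX iX)) a fa)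
    dc : ∀ p q → PrF (σ ↑) f q → PP ((σ ⇒ τ) ↑) p → p ⊑ q → PrF (σ ↑) f p
    dc (fn Y b) (fn X a) (ppX , iX , fa) ppYb (X≤Y , b⊑a) =
      let ppY , iY , ppb = PP-fn⁻ σ τ Y b ppYb
          fX = antichain-FinElem _ X ppX iX
          fY = antichain-FinElem _ Y ppY iY
          fa' = monotone F X Y fX fY (down-mono _ (Below⇒⊆↓ X Y X≤Y)) a fa
      in ppY , iY , elem-down (f↓-elem Y fY) b a fa' ppb b⊑a
    -- (X,a) and (Y,b) are compared inside f ↓(X ++ Y), which contains f ↓X and f ↓Y
    cons : ∀ p q → PrF (σ ↑) f p → PrF (σ ↑) f q → p ≍ q
    cons (fn X a) (fn Y b) (ppX , iX , fa) (ppY , iY , fb) cXY =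
      elem-cons (f↓-elem (X ++ Y) fXY) a b
        (monotone F X (X ++ Y) fX fXY (down-mono _ (λ q → ++⁺ˡ)) a fa)
        (monotone F Y (X ++ Y) fY fXY (down-mono _ (λ q → ++⁺ʳ X)) b fb)
      where
        fX : FinElem (σ ↑) X
        fX = antichain-FinElem _ X ppX iX
        fY : FinElem (σ ↑) Y
        fY = antichain-FinElem _ Y ppY iY
        fXY : FinElem (σ ↑) (X ++ Y)
        fXY = ++⁺ ppX ppY , Consistent-++ X Y (proj₂ fX) (proj₂ fY) (AllCons⇒Cross X Y cXY)

elemFun : ∀ {T U} f → (∀ d → IsElem T d → IsElem U (f d)) → Monotone f → ElemFun T U f
elemFun f f-elem f-mono = record { preserves = f-elem ; monotone = λ _ _ _ _ → f-mono }

MonoFirst : TypeTree → TypeTree → (PSet → PSet → PSet) → Set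
MonoFirst T S f = ∀ X Y → FinElem T X → FinElem T Y → down T X ⊆ down T Y →
                  ∀ Z → FinElem S Z → f (down T X) (down S Z) ⊆ f (down T Y) (down S Z)

elemFun-curry : ∀ {T} σ τ (f : PSet → PSet → PSet) →
                (∀ d → IsElem T d → ElemFun (σ ↑) (τ ↑) (f d)) → MonoFirst T (σ ↑) f →
                ElemFun T ((σ ⇒ τ) ↑) (λ d → PrF (σ ↑) (f d))
elemFun-curry σ τ f F f-mono = record
  { preserves = λ d e → PrF-elem σ τ (f d) (F d e)
  ; monotone = λ X Y fX fY h → PrF-mono (σ ↑) _ _ (f-mono X Y fX fY h) }

apply-elem : ∀ σ τ r d → IsElem ((σ ⇒ τ) ↑) r → IsElem (σ ↑) d → IsElem (τ ↑) (apply r d)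
apply-elem σ τ r d er ed = pp , dc , cons
  where
    pp : ∀ a → apply r d a → PP (τ ↑) a
    pp a (X , dX , rX) = proj₂ (proj₂ (PP-fn⁻ σ τ X a (elem-PP er _ rX)))
    dc : ∀ b a → apply r d a → PP (τ ↑) b → b ⊑ a → apply r d b
    dc b a (X , dX , rX) ppb b⊑a =
      let ppX , iX , _ = PP-fn⁻ σ τ X a (elem-PP er _ rX)
      in X , dX , elem-down er (fn X b) (fn X a) rX (PP-fn⁺ σ τ X b ppX iX ppb) (Below-refl X , b⊑a)
    cons : ∀ a b → apply r d a → apply r d b → a ≍ b
    cons a b (X , dX , rX) (Y , dY , rY) =
      elem-cons er (fn X a) (fn Y b) rX rY (Cross⇒AllCons X Y (cross (elem-cons ed) dX dY))

projD : Fin 2 → PSet → PSet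
projD i p a = p (prj i a)

inD-elem : ∀ i σ τ d → IsElem (sel i σ τ ↑) d → IsElem ((σ ⊕ τ) ↑) (inD i d)
inD-elem i σ τ d e = pp , dc , cons
  where
    pp : ∀ p → inD i d p → PP ((σ ⊕ τ) ↑) p
    pp (tag j) _ = PP-tag σ τ j
    pp (inj j a) (refl , da) = PP-inj⁺ σ τ j a (elem-PP e a da)
    dc : ∀ p q → inD i d q → PP ((σ ⊕ τ) ↑) p → p ⊑ q → inD i d p
    dc (tag k) (tag j) j≡i _ k≡j = trans k≡j j≡i
    dc (tag k) (inj j a) (j≡i , _) _ k≡j = trans k≡j j≡i
    dc (inj k b) (inj j a) (refl , da) pp (refl , b⊑a) = refl , elem-down e b a da (PP-inj⁻ σ τ k b pp) b⊑a
    cons : ∀ p q → inD i d p → inD i d q → p ≍ q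
    cons (tag j) (tag k) j≡i k≡i = trans j≡i (sym k≡i)
    cons (tag j) (inj k a) j≡i (k≡i , _) = trans j≡i (sym k≡i)
    cons (inj j a) (tag k) (j≡i , _) k≡i = trans j≡i (sym k≡i)
    cons (inj j a) (inj k b) (j≡i , da) (k≡i , db) = trans j≡i (sym k≡i) , elem-cons e a b da db

inD-mono : ∀ i → Monotone (inD i)
inD-mono i h (tag j) j≡i = j≡i
inD-mono i h (inj j a) (j≡i , x) = j≡i , h a x

outD-elem : ∀ i σ τ d → IsElem ((σ ⊕ τ) ↑) d → IsElem (sel i σ τ ↑) (outD i d)
outD-elem i σ τ d e =
  (λ a x → PP-inj⁻ σ τ i a (elem-PP e _ x)) ,
  (λ b a x ppb b⊑a → elem-down e (inj i b) (inj i a) x (PP-inj⁺ σ τ i b ppb) (refl , b⊑a)) ,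
  (λ a b x y → proj₂ (elem-cons e _ _ x y))

-- distinct tags are inconsistent, so an element of a sum type selects one branch
tags-differ : tag zero ≍ tag (suc zero) → ⊥
tags-differ ()

caseD-elem : ∀ σ τ ρ d f g → IsElem ((σ ⊕ τ) ↑) d → IsElem ((σ ⇒ ρ) ↑) f → IsElem ((τ ⇒ ρ) ↑) g →
             IsElem (ρ ↑) (caseD d f g)
caseD-elem σ τ ρ d f g ed ef eg = pp , dc , cons
  where
    e₀ : IsElem (ρ ↑) (apply f (outD zero d))
    e₀ = apply-elem σ ρ f (outD zero d) ef (outD-elem zero σ τ d ed)
    e₁ : IsElem (ρ ↑) (apply g (outD (suc zero) d))
    e₁ = apply-elem τ ρ g (outD (suc zero) d) eg (outD-elem (suc zero) σ τ d ed)
    pp : ∀ p → caseD d f g p → PP (ρ ↑) p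
    pp p (inj₁ (_ , x)) = elem-PP e₀ p x
    pp p (inj₂ (_ , x)) = elem-PP e₁ p x
    dc : ∀ p q → caseD d f g q → PP (ρ ↑) p → p ⊑ q → caseD d f g p
    dc p q (inj₁ (t , x)) pq p⊑q = inj₁ (t , elem-down e₀ p q x pq p⊑q)
    dc p q (inj₂ (t , x)) pq p⊑q = inj₂ (t , elem-down e₁ p q x pq p⊑q)
    cons : ∀ p q → caseD d f g p → caseD d f g q → p ≍ q
    cons p q (inj₁ (_ , x)) (inj₁ (_ , y)) = elem-cons e₀ p q x y
    cons p q (inj₂ (_ , x)) (inj₂ (_ , y)) = elem-cons e₁ p q x y
    cons p q (inj₁ (t , _)) (inj₂ (t' , _)) = ⊥-elim (tags-differ (elem-cons ed _ _ t t'))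
    cons p q (inj₂ (t , _)) (inj₁ (t' , _)) = ⊥-elim (tags-differ (elem-cons ed _ _ t' t))

caseD-mono : ∀ {d d' f f' g g'} → d ⊆ d' → f ⊆ f' → g ⊆ g' → caseD d f g ⊆ caseD d' f' g'
caseD-mono hd hf hg p (inj₁ (t , x)) = inj₁ (hd _ t , apply-mono hf (λ a → hd (inj zero a)) p x)
caseD-mono hd hf hg p (inj₂ (t , x)) = inj₂ (hd _ t , apply-mono hg (λ a → hd (inj (suc zero) a)) p x)

pcaseD-together : ∀ {S} a b c {p q} → IsElem S a → pcaseD a b c p → pcaseD a b c q → (b p × b q) ⊎ (c p × c q)
pcaseD-together a b c e (inj₁ (_ , bp , _)) (inj₁ (_ , bq , _)) = inj₁ (bp , bq)
pcaseD-together a b c e (inj₁ (_ , bp , _)) (inj₂ (inj₁ (_ , bq))) = inj₁ (bp , bq)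
pcaseD-together a b c e (inj₁ (_ , _ , cp)) (inj₂ (inj₂ (_ , cq))) = inj₂ (cp , cq)
pcaseD-together a b c e (inj₂ (inj₁ (_ , bp))) (inj₁ (_ , bq , _)) = inj₁ (bp , bq)
pcaseD-together a b c e (inj₂ (inj₁ (_ , bp))) (inj₂ (inj₁ (_ , bq))) = inj₁ (bp , bq)
pcaseD-together a b c e (inj₂ (inj₂ (_ , cp))) (inj₁ (_ , _ , cq)) = inj₂ (cp , cq)
pcaseD-together a b c e (inj₂ (inj₂ (_ , cp))) (inj₂ (inj₂ (_ , cq))) = inj₂ (cp , cq)
pcaseD-together a b c e (inj₂ (inj₁ (t , _))) (inj₂ (inj₂ (t' , _))) = ⊥-elim (tags-differ (elem-cons e _ _ t t'))
pcaseD-together a b c e (inj₂ (inj₂ (t , _))) (inj₂ (inj₁ (t' , _))) = ⊥-elim (tags-differ (elem-cons e _ _ t' t))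

pcaseD-map : ∀ a b b' c c' {p q} → (b q → b' p) → (c q → c' p) → pcaseD a b c q → pcaseD a b' c' p
pcaseD-map a b b' c c' hb hc (inj₁ (E , x , y)) = inj₁ (E , hb x , hc y)
pcaseD-map a b b' c c' hb hc (inj₂ (inj₁ (t , x))) = inj₂ (inj₁ (t , hb x))
pcaseD-map a b b' c c' hb hc (inj₂ (inj₂ (t , x))) = inj₂ (inj₂ (t , hc x))

pcaseD-monoBC : ∀ a {b b' c c'} → b ⊆ b' → c ⊆ c' → pcaseD a b c ⊆ pcaseD a b' c'
pcaseD-monoBC a {b} {b'} {c} {c'} hb hc p = pcaseD-map a b b' c c' (hb p) (hc p)

pcaseD-elem : ∀ S ρ a b c → IsElem S a → IsElem (ρ ↑) b → IsElem (ρ ↑) c → IsElem (ρ ↑) (pcaseD a b c)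
pcaseD-elem S ρ a b c ea eb ec = pp , dc , cons
  where
    pp : ∀ p → pcaseD a b c p → PP (ρ ↑) p
    pp p x with pcaseD-together a b c ea x x
    ... | inj₁ (bp , _) = elem-PP eb p bp
    ... | inj₂ (cp , _) = elem-PP ec p cp
    dc : ∀ p q → pcaseD a b c q → PP (ρ ↑) p → p ⊑ q → pcaseD a b c p
    dc p q x pq p⊑q = pcaseD-map a b b c c (λ bq → elem-down eb p q bq pq p⊑q) (λ cq → elem-down ec p q cq pq p⊑q) x
    cons : ∀ p q → pcaseD a b c p → pcaseD a b c q → p ≍ q
    cons p q x y with pcaseD-together a b c ea x y
    ... | inj₁ (bp , bq) = elem-cons eb p q bp bq
    ... | inj₂ (cp , cq) = elem-cons ec p q cp cq

-- In its scrutinee pcase is monotone only on finite elements: an empty scrutinee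
-- may grow into one carrying a tag, which is decided by inspecting the list.
pcaseD-monoA : ∀ σ τ X Y {b c} → All (PP ((σ ⊕ τ) ↑)) Y → down ((σ ⊕ τ) ↑) X ⊆ down ((σ ⊕ τ) ↑) Y →
               pcaseD (down ((σ ⊕ τ) ↑) X) b c ⊆ pcaseD (down ((σ ⊕ τ) ↑) Y) b c
pcaseD-monoA σ τ X Y ppY h p (inj₂ (inj₁ (t , x))) = inj₂ (inj₁ (h _ t , x))
pcaseD-monoA σ τ X Y ppY h p (inj₂ (inj₂ (t , x))) = inj₂ (inj₂ (h _ t , x))
pcaseD-monoA σ τ X [] [] h p (inj₁ (_ , x , y)) = inj₁ ((λ q ()) , x , y)
pcaseD-monoA σ τ X (y ∷ Y) (ppy ∷ _) h p (inj₁ (_ , bp , cp)) with PP-sum-tag σ τ y ppy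
... | zero , tag⊑y = inj₂ (inj₁ ((PP-tag σ τ zero , here tag⊑y) , bp))
... | suc zero , tag⊑y = inj₂ (inj₂ ((PP-tag σ τ (suc zero) , here tag⊑y) , cp))

pairD-elem : ∀ σ τ d e → IsElem (σ ↑) d → IsElem (τ ↑) e → IsElem ((σ ⊗ τ) ↑) (pairD d e)
pairD-elem σ τ d e ed ee = pp , dc , cons
  where
    pp : ∀ p → pairD d e p → PP ((σ ⊗ τ) ↑) p
    pp (prj zero a) x = PP-prj⁺ σ τ zero a (elem-PP ed a x)
    pp (prj (suc zero) a) x = PP-prj⁺ σ τ (suc zero) a (elem-PP ee a x)
    dc : ∀ p q → pairD d e q → PP ((σ ⊗ τ) ↑) p → p ⊑ q → pairD d e p
    dc (prj zero b) (prj zero a) x pp (refl , b⊑a) = elem-down ed b a x (PP-prj⁻ σ τ zero b pp) b⊑a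
    dc (prj (suc zero) b) (prj (suc zero) a) x pp (refl , b⊑a) = elem-down ee b a x (PP-prj⁻ σ τ (suc zero) b pp) b⊑a
    cons : ∀ p q → pairD d e p → pairD d e q → p ≍ q
    cons (prj zero a) (prj zero b) x y = inj₂ (refl , elem-cons ed a b x y)
    cons (prj zero a) (prj (suc zero) b) x y = inj₁ λ ()
    cons (prj (suc zero) a) (prj zero b) x y = inj₁ λ ()
    cons (prj (suc zero) a) (prj (suc zero) b) x y = inj₂ (refl , elem-cons ee a b x y)

pairD-mono : ∀ {d d' e e'} → d ⊆ d' → e ⊆ e' → pairD d e ⊆ pairD d' e'
pairD-mono hd he (prj zero a) x = hd a x
pairD-mono hd he (prj (suc zero) a) x = he a x

projD-elem : ∀ i σ τ p → IsElem ((σ ⊗ τ) ↑) p → IsElem (sel i σ τ ↑) (projD i p)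
projD-elem i σ τ p e =
  (λ a x → PP-prj⁻ σ τ i a (elem-PP e _ x)) ,
  (λ b a x ppb b⊑a → elem-down e (prj i b) (prj i a) x (PP-prj⁺ σ τ i b ppb) (refl , b⊑a)) ,
  (λ a b x y → same-component (elem-cons e _ _ x y))
  where same-component : ∀ {a b} → prj i a ≍ prj i b → a ≍ b
        same-component (inj₁ i≢i) = ⊥-elim (i≢i refl)
        same-component (inj₂ (_ , a≍b)) = a≍b

projD-mono : ∀ i → Monotone (projD i)
projD-mono i h a = h (prj i a)

const-elem : ∀ c → IsElem (typeOf c ↑) ⟦ c ⟧ᶜ
const-elem (c0 σ τ) = PrF-elem σ (σ ⊕ τ) _ (elemFun _ (inD-elem zero σ τ) (inD-mono zero))
const-elem (c1 σ τ) = PrF-elem τ (σ ⊕ τ) _ (elemFun _ (inD-elem (suc zero) σ τ) (inD-mono (suc zero)))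
const-elem (ccase σ τ ρ) = PrF-elem (σ ⊕ τ) _ _ (elemFun-curry (σ ⇒ ρ) ((τ ⇒ ρ) ⇒ ρ) _ case-d case-mono)
  where
    S F G : TypeTree
    S = (σ ⊕ τ) ↑
    F = (σ ⇒ ρ) ↑
    G = (τ ⇒ ρ) ↑
    case-d : ∀ d → IsElem S d → ElemFun F (((τ ⇒ ρ) ⇒ ρ) ↑) (λ f → PrF G (caseD d f))
    case-d d ed =
      elemFun-curry (τ ⇒ ρ) ρ (caseD d)
        (λ f ef → elemFun _ (λ g → caseD-elem σ τ ρ d f g ed ef) (caseD-mono {d} {d} {f} {f} ⊆-refl ⊆-refl))
        (λ X Y _ _ h Z _ → caseD-mono {d} {d} {g = down G Z} ⊆-refl h ⊆-refl)
    case-mono : MonoFirst S F (λ d f → PrF G (caseD d f))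
    case-mono X Y _ _ h Z _ = PrF-mono G _ _ λ W _ → caseD-mono {f = down F Z} {g = down G W} h ⊆-refl ⊆-refl
const-elem (cpcase σ τ ρ) = PrF-elem (σ ⊕ τ) _ _ (elemFun-curry ρ (ρ ⇒ ρ) _ pcase-a pcase-mono)
  where
    S R : TypeTree
    S = (σ ⊕ τ) ↑
    R = ρ ↑
    pcase-a : ∀ a → IsElem S a → ElemFun R ((ρ ⇒ ρ) ↑) (λ b → PrF R (pcaseD a b))
    pcase-a a ea = elemFun-curry ρ ρ (pcaseD a)
                     (λ b eb → elemFun _ (λ c → pcaseD-elem S ρ a b c ea eb) (pcaseD-monoBC a ⊆-refl))
                     (λ X Y _ _ h Z _ → pcaseD-monoBC a h ⊆-refl)
    pcase-mono : MonoFirst S R (λ a b → PrF R (pcaseD a b))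
    pcase-mono X Y _ (ppY , _) h Z _ = PrF-mono R _ _ λ W _ → pcaseD-monoA σ τ X Y ppY h
const-elem (cpair σ τ) =
  PrF-elem σ (τ ⇒ (σ ⊗ τ)) _
    (elemFun-curry τ (σ ⊗ τ) pairD
       (λ d ed → elemFun _ (λ e → pairD-elem σ τ d e ed) (pairD-mono ⊆-refl))
       (λ X Y _ _ h Z _ → pairD-mono h ⊆-refl))
const-elem (cfst σ τ) = PrF-elem (σ ⊗ τ) σ _ (elemFun _ (projD-elem zero σ τ) (projD-mono zero))
const-elem (csnd σ τ) = PrF-elem (σ ⊗ τ) τ _ (elemFun _ (projD-elem (suc zero) σ τ) (projD-mono (suc zero)))
const-elem (cΩ σ) = ∅-elem _

EnvOK : List Type → Env → Set
EnvOK Γ ε = ∀ i σ → VarOK Γ i σ → IsElem (σ ↑) (ε i σ)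

EnvOK-extend : ∀ {Γ ε σ d} → EnvOK Γ ε → IsElem (σ ↑) d → EnvOK (σ ∷ Γ) (extend ε d)
EnvOK-extend h ed zero σ refl = ed
EnvOK-extend h ed (suc i) σ ok = h i σ ok

sound : ∀ {Γ M τ} → Γ ⊢ M ∶ τ → ∀ ε → EnvOK Γ ε → IsElem (τ ↑) (⟦ M ⟧ ε)
sound (tv {i} {σ} ok) ε h = h i σ ok
sound (tcon {c}) ε h = const-elem c
sound (tlam {σ} {τ} {M} d) ε h =
  PrF-elem σ τ _ (elemFun _ (λ e ee → sound d (extend ε e) (EnvOK-extend h ee))
                            (sem-mono M ∘ extend-mono (λ _ _ → ⊆-refl)))
sound (tapp {σ} {τ} d e) ε h = apply-elem σ τ _ _ (sound d ε h) (sound e ε h)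
sound (tconv d σ≈τ) ε h = elem-tree σ≈τ (sound d ε h)

Cont-inD : ∀ i T d → (∀ p → d p → PP T p) → Cont T d (inD i)
Cont-inD i T d pp (tag j) j≡i = [] , [] , j≡i
Cont-inD i T d pp (inj j a) (j≡i , da) = let L , dL , a∈↓L = Cont-id T d pp a da in L , dL , j≡i , a∈↓L

Cont-projD : ∀ i T d → (∀ p → d p → PP T p) → Cont T d (projD i)
Cont-projD i T d pp a = Cont-id T d pp (prj i a)

Cont-pairD : ∀ T x D E → Cont T x D → Cont T x E → Cont T x (λ e → pairD (D e) (E e))
Cont-pairD T x D E D-cont E-cont (prj zero a) = D-cont a
Cont-pairD T x D E D-cont E-cont (prj (suc zero) a) = E-cont a

Cont-case-branch : ∀ T x i {D H} → Monotone D → Monotone H → Cont T x D → Cont T x H →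
                   ∀ a → D x (tag i) → apply (H x) (outD i (D x)) a →
                   ∃ λ L → All x L × D (down T L) (tag i) × apply (H (down T L)) (outD i (D (down T L))) a
Cont-case-branch T x i D-mono H-mono D-cont H-cont a t ap =
  let L₁ , xL₁ , t' = D-cont (tag i) t
      L₂ , xL₂ , ap' = Cont-apply T x H-mono (λ h a → D-mono h (inj i a)) H-cont (λ a → D-cont (inj i a)) a ap
  in L₁ ++ L₂ , ++⁺ xL₁ xL₂ , D-mono (down-++ˡ T L₁ L₂) _ t' ,
     apply-mono (H-mono (down-++ʳ T L₁ L₂)) (λ a → D-mono (down-++ʳ T L₁ L₂) (inj i a)) a ap'

Cont-caseD : ∀ T x D F G → Monotone D → Monotone F → Monotone G → Cont T x D → Cont T x F → Cont T x G →
             Cont T x (λ e → caseD (D e) (F e) (G e))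
Cont-caseD T x D F G D-mono F-mono G-mono D-cont F-cont G-cont a (inj₁ (t , ap)) =
  let L , xL , t' , ap' = Cont-case-branch T x zero D-mono F-mono D-cont F-cont a t ap in L , xL , inj₁ (t' , ap')
Cont-caseD T x D F G D-mono F-mono G-mono D-cont F-cont G-cont a (inj₂ (t , ap)) =
  let L , xL , t' , ap' = Cont-case-branch T x (suc zero) D-mono G-mono D-cont G-cont a t ap in L , xL , inj₂ (t' , ap')

Cont-pcaseD : ∀ T x a B C → Monotone B → Monotone C → Cont T x B → Cont T x C →
              Cont T x (λ e → pcaseD a (B e) (C e))
Cont-pcaseD T x a B C B-mono C-mono B-cont C-cont p (inj₁ (E , bp , cp)) =
  let L₁ , xL₁ , bp' = B-cont p bp
      L₂ , xL₂ , cp' = C-cont p cp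
  in L₁ ++ L₂ , ++⁺ xL₁ xL₂ , inj₁ (E , B-mono (down-++ˡ T L₁ L₂) p bp' , C-mono (down-++ʳ T L₁ L₂) p cp')
Cont-pcaseD T x a B C B-mono C-mono B-cont C-cont p (inj₂ (inj₁ (t , bp))) =
  let L , xL , bp' = B-cont p bp in L , xL , inj₂ (inj₁ (t , bp'))
Cont-pcaseD T x a B C B-mono C-mono B-cont C-cont p (inj₂ (inj₂ (t , cp))) =
  let L , xL , cp' = C-cont p cp in L , xL , inj₂ (inj₂ (t , cp'))

apply-PrF-comm : ∀ S g X Y → apply (apply (PrF S g) X) Y ≐ apply (PrF S (λ d → apply (g d) Y)) X
apply-PrF-comm S g X Y p =
  (λ (Ys , yYs , Xs , xXs , pp , ind , gp) → Xs , xXs , pp , ind , Ys , yYs , gp) ,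
  (λ (Xs , xXs , pp , ind , Ys , yYs , gp) → Ys , yYs , Xs , xXs , pp , ind , gp)

apply₃-PrF : ∀ S k X Y Z → apply (apply (apply (PrF S k) X) Y) Z ≐ apply (PrF S (λ d → apply (apply (k d) Y) Z)) X
apply₃-PrF S k X Y Z = ≐-trans (apply-resp (apply-PrF-comm S k X Y) ≐-refl)
                               (apply-PrF-comm S (λ d → apply (k d) Y) X Z)

Cont-PrF : ∀ T U d (h : PSet → PSet → PSet) → (∀ g → Cont T d (λ f → h f g)) → Cont T d (λ f → PrF U (h f))
Cont-PrF T U d h h-cont (fn Y b) (ppY , iY , x) = let L , dL , y = h-cont (down U Y) b x in L , dL , ppY , iY , y

Monotone₂ : (PSet → PSet → PSet) → Set₁
Monotone₂ h = ∀ {f f' g g'} → f ⊆ f' → g ⊆ g' → h f g ⊆ h f' g'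

beta₂ : ∀ F G h Y Z → IsElem F Y → IsElem G Z → Monotone₂ h →
        (∀ g → Cont F Y (λ f → h f g)) → (∀ f → Cont G Z (h f)) →
        apply (apply (PrF F (λ f → PrF G (h f))) Y) Z ≐ h Y Z
beta₂ F G h Y Z eY eZ h-mono h-cont₁ h-cont₂ = begin
  apply (apply (PrF F (λ f → PrF G (h f))) Y) Z
    ≈⟨ apply-resp (beta F _ Y eY (λ {f} {f'} hf → PrF-mono G (h f) (h f') λ W _ → h-mono hf ⊆-refl)
                        (Cont-PrF F G Y h h-cont₁)) ≐-refl ⟩
  apply (PrF G (h Y)) Z
    ≈⟨ beta G (h Y) Z eZ (h-mono ⊆-refl) (h-cont₂ Y) ⟩
  h Y Z ∎
  where open ≐-Reasoning

inC projC : Fin 2 → Type → Type → Const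
inC zero = c0
inC (suc zero) = c1
projC zero = cfst
projC (suc zero) = csnd

const-mono : ∀ {c} → Monotone (λ _ → c)
const-mono _ = ⊆-refl

id-mono : Monotone (λ e → e)
id-mono h = h

sem-inC : ∀ i σ τ X → IsElem (sel i σ τ ↑) X → apply ⟦ inC i σ τ ⟧ᶜ X ≐ inD i X
sem-inC zero σ τ X e = beta (σ ↑) (inD zero) X e (inD-mono zero) (Cont-inD zero _ X (elem-PP e))
sem-inC (suc zero) σ τ X e = beta (τ ↑) (inD (suc zero)) X e (inD-mono (suc zero)) (Cont-inD (suc zero) _ X (elem-PP e))

sem-pair : ∀ σ τ X Y → IsElem (σ ↑) X → IsElem (τ ↑) Y → apply (apply ⟦ cpair σ τ ⟧ᶜ X) Y ≐ pairD X Y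
sem-pair σ τ X Y eX eY =
  beta₂ (σ ↑) (τ ↑) pairD X Y eX eY pairD-mono
        (λ g → Cont-pairD (σ ↑) X (λ f → f) (λ _ → g) (Cont-id (σ ↑) X (elem-PP eX)) (Cont-const (σ ↑) X g))
        (λ f → Cont-pairD (τ ↑) Y (λ _ → f) (λ g → g) (Cont-const (τ ↑) Y f) (Cont-id (τ ↑) Y (elem-PP eY)))

sem-projC : ∀ i σ τ P → IsElem ((σ ⊗ τ) ↑) P → apply ⟦ projC i σ τ ⟧ᶜ P ≐ projD i P
sem-projC zero σ τ P e = beta _ (projD zero) P e (projD-mono zero) (Cont-projD zero _ P (elem-PP e))
sem-projC (suc zero) σ τ P e = beta _ (projD (suc zero)) P e (projD-mono (suc zero)) (Cont-projD (suc zero) _ P (elem-PP e))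

caseD-resp : ∀ {d d' f f' g g'} → d ≐ d' → f ≐ f' → g ≐ g' → caseD d f g ≐ caseD d' f' g'
caseD-resp hd hf hg p = caseD-mono (⊆-of hd) (⊆-of hf) (⊆-of hg) p ,
                        caseD-mono (⊆-of (≐-sym hd)) (⊆-of (≐-sym hf)) (⊆-of (≐-sym hg)) p

inD-resp : ∀ i {d d'} → d ≐ d' → inD i d ≐ inD i d'
inD-resp i h p = inD-mono i (⊆-of h) p , inD-mono i (⊆-of (≐-sym h)) p

pairD-resp : ∀ {d d' e e'} → d ≐ d' → e ≐ e' → pairD d e ≐ pairD d' e'
pairD-resp hd he p = pairD-mono (⊆-of hd) (⊆-of he) p , pairD-mono (⊆-of (≐-sym hd)) (⊆-of (≐-sym he)) p

caseD-inD : ∀ i X Y Z → caseD (inD i X) Y Z ≐ apply (sel i Y Z) X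
caseD-inD zero X Y Z p =
  [ (λ (_ , w) → apply-mono {Y} ⊆-refl (λ a → proj₂) p w) , (λ { (() , _) }) ] ,
  (λ w → inj₁ (refl , apply-mono {Y} ⊆-refl (λ a → refl ,_) p w))
caseD-inD (suc zero) X Y Z p =
  [ (λ { (() , _) }) , (λ (_ , w) → apply-mono {Z} ⊆-refl (λ a → proj₂) p w) ] ,
  (λ w → inj₂ (refl , apply-mono {Z} ⊆-refl (λ a → refl ,_) p w))

projD-pairD : ∀ i X Y → projD i (pairD X Y) ≡ sel i X Y
projD-pairD zero X Y = refl
projD-pairD (suc zero) X Y = refl

sem-case : ∀ σ τ ρ A Y Z → IsElem ((σ ⊕ τ) ↑) A → IsElem ((σ ⇒ ρ) ↑) Y → IsElem ((τ ⇒ ρ) ↑) Z →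
           apply (apply (apply ⟦ ccase σ τ ρ ⟧ᶜ A) Y) Z ≐ caseD A Y Z
sem-case σ τ ρ A Y Z eA eY eZ = begin
  apply (apply (apply ⟦ ccase σ τ ρ ⟧ᶜ A) Y) Z
    ≈⟨ apply₃-PrF S k A Y Z ⟩
  apply (PrF S (λ d → apply (apply (k d) Y) Z)) A
    ≈⟨ apply-resp (PrF-resp S (λ d → apply (apply (k d) Y) Z) (λ d → caseD d Y Z) λ Xs _ → branches (down S Xs))
                  ≐-refl ⟩
  apply (PrF S (λ d → caseD d Y Z)) A
    ≈⟨ beta S (λ d → caseD d Y Z) A eA (λ h → caseD-mono h (⊆-refl {Y}) (⊆-refl {Z}))
            (Cont-caseD S A (λ d → d) (λ _ → Y) (λ _ → Z) id-mono const-mono const-mono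
               (Cont-id S A (elem-PP eA)) (Cont-const S A Y) (Cont-const S A Z)) ⟩
  caseD A Y Z ∎
  where
    open ≐-Reasoning
    S F G : TypeTree
    S = (σ ⊕ τ) ↑
    F = (σ ⇒ ρ) ↑
    G = (τ ⇒ ρ) ↑
    k : PSet → PSet
    k d = PrF F (λ f → PrF G (caseD d f))
    branches : ∀ d → apply (apply (k d) Y) Z ≐ caseD d Y Z
    branches d =
      beta₂ F G (caseD d) Y Z eY eZ (caseD-mono {d} ⊆-refl)
        (λ g → Cont-caseD F Y (λ _ → d) (λ f → f) (λ _ → g) const-mono id-mono const-mono
                 (Cont-const F Y d) (Cont-id F Y (elem-PP eY)) (Cont-const F Y g))
        (λ f → Cont-caseD G Z (λ _ → d) (λ _ → f) (λ g → g) const-mono const-mono id-mono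
                 (Cont-const G Z d) (Cont-const G Z f) (Cont-id G Z (elem-PP eZ)))

-- pcase is β-reduced in its branches only; in the scrutinee it is not monotone
PCase : TypeTree → PSet → PSet → PSet → PSet
PCase S X Y Z = apply (PrF S (λ a → pcaseD a Y Z)) X

sem-pcase : ∀ σ τ ρ X Y Z → IsElem (ρ ↑) Y → IsElem (ρ ↑) Z →
            apply (apply (apply ⟦ cpcase σ τ ρ ⟧ᶜ X) Y) Z ≐ PCase ((σ ⊕ τ) ↑) X Y Z
sem-pcase σ τ ρ X Y Z eY eZ =
  ≐-trans (apply₃-PrF S k X Y Z)
          (apply-resp (PrF-resp S (λ a → apply (apply (k a) Y) Z) (λ a → pcaseD a Y Z) λ Xs _ → branches (down S Xs))
                      ≐-refl)
  where
    S R : TypeTree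
    S = (σ ⊕ τ) ↑
    R = ρ ↑
    k : PSet → PSet
    k a = PrF R (λ b → PrF R (pcaseD a b))
    branches : ∀ a → apply (apply (k a) Y) Z ≐ pcaseD a Y Z
    branches a =
      beta₂ R R (pcaseD a) Y Z eY eZ (pcaseD-monoBC a)
        (λ c → Cont-pcaseD R Y a (λ b → b) (λ _ → c) id-mono const-mono (Cont-id R Y (elem-PP eY)) (Cont-const R Y c))
        (λ b → Cont-pcaseD R Z a (λ _ → b) (λ c → c) const-mono id-mono (Cont-const R Z b) (Cont-id R Z (elem-PP eZ)))

PCase-resp : ∀ S X {Y Y' Z Z'} → Y ≐ Y' → Z ≐ Z' → PCase S X Y Z ≐ PCase S X Y' Z'
PCase-resp S X {Y} {Y'} {Z} {Z'} hY hZ =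
  apply-resp (PrF-resp S (λ a → pcaseD a Y Z) (λ a → pcaseD a Y' Z') λ Xs _ p →
                pcaseD-monoBC (down S Xs) (⊆-of hY) (⊆-of hZ) p ,
                pcaseD-monoBC (down S Xs) (⊆-of (≐-sym hY)) (⊆-of (≐-sym hZ)) p)
             ≐-refl

pcaseD-branch : ∀ a b c {p} → pcaseD a b c p → b p ⊎ c p
pcaseD-branch a b c (inj₁ (_ , bp , _)) = inj₁ bp
pcaseD-branch a b c (inj₂ (inj₁ (_ , bp))) = inj₁ bp
pcaseD-branch a b c (inj₂ (inj₂ (_ , cp))) = inj₂ cp

pcaseD-select : ∀ i a b c {p} → a (tag i) → sel i b c p → pcaseD a b c p
pcaseD-select zero a b c t x = inj₂ (inj₁ (t , x))
pcaseD-select (suc zero) a b c t x = inj₂ (inj₂ (t , x))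

pcaseD-tagged : ∀ i a b c {p} → (∀ j → a (tag j) → j ≡ i) → pcaseD a b c p → sel i b c p
pcaseD-tagged i a b c {p} tags (inj₁ (_ , bp , cp)) = sel-elim (λ d → d p) i {b} {c} bp cp
pcaseD-tagged i a b c {p} tags (inj₂ (inj₁ (t , bp))) = subst (λ k → sel k b c p) (tags zero t) bp
pcaseD-tagged i a b c {p} tags (inj₂ (inj₂ (t , cp))) = subst (λ k → sel k b c p) (tags (suc zero) t) cp

-- a scrutinee element carrying tag i can only carry tag i, by consistency
PCase-tagged : ∀ S i A Y Z → IsElem S A → A (tag i) → PCase S A Y Z ≐ sel i Y Z
PCase-tagged S i A Y Z eA Ai p = to , from
  where
    to : PCase S A Y Z p → sel i Y Z p
    to (Xs , AXs , _ , _ , pc) = pcaseD-tagged i _ Y Z (λ j t → elem-cons eA _ _ (down⊆ Xs eA AXs (tag j) t) Ai) pc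
    from : sel i Y Z p → PCase S A Y Z p
    from x = tag i ∷ [] , Ai ∷ [] , pp ∷ [] , [] ∷ [] , pcaseD-select i _ Y Z (pp , here refl) x
      where pp : PP S (tag i)
            pp = elem-PP eA (tag i) Ai

PCase-branch : ∀ S X Y Z {p} → PCase S X Y Z p → Y p ⊎ Z p
PCase-branch S X Y Z (Xs , _ , _ , _ , pc) = pcaseD-branch (down S Xs) Y Z pc

PCase-inD : ∀ S i X Y Z → PCase S X (inD i Y) (inD i Z) ≐ inD i (PCase S X Y Z)
PCase-inD S i X Y Z (tag j) = [ id , id ] ∘ PCase-branch S X (inD i Y) (inD i Z) , from
  where
    -- the empty list of scrutinee primes selects both branches
    from : j ≡ i → PCase S X (inD i Y) (inD i Z) (tag j)
    from j≡i = [] , [] , [] , [] , inj₁ ((λ q ()) , j≡i , j≡i)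
PCase-inD S i X Y Z (inj j q) = to , from
  where
    to : PCase S X (inD i Y) (inD i Z) (inj j q) → inD i (PCase S X Y Z) (inj j q)
    to x@(Xs , xXs , pp , ind , pc) =
      [ proj₁ , proj₁ ] (PCase-branch S X (inD i Y) (inD i Z) x) ,
      Xs , xXs , pp , ind , pcaseD-map (down S Xs) (inD i Y) Y (inD i Z) Z proj₂ proj₂ pc
    from : inD i (PCase S X Y Z) (inj j q) → PCase S X (inD i Y) (inD i Z) (inj j q)
    from (j≡i , Xs , xXs , pp , ind , pc) =
      Xs , xXs , pp , ind , pcaseD-map (down S Xs) Y (inD i Y) Z (inD i Z) (j≡i ,_) (j≡i ,_) pc
PCase-inD S i X Y Z (prj j q) = [ (λ ()) , (λ ()) ] ∘ PCase-branch S X (inD i Y) (inD i Z) {prj j q} , λ ()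
PCase-inD S i X Y Z (fn W q) = [ (λ ()) , (λ ()) ] ∘ PCase-branch S X (inD i Y) (inD i Z) {fn W q} , λ ()

PCase-pairD : ∀ S X Y₁ Y₂ Z₁ Z₂ → PCase S X (pairD Y₁ Y₂) (pairD Z₁ Z₂) ≐ pairD (PCase S X Y₁ Z₁) (PCase S X Y₂ Z₂)
PCase-pairD S X Y₁ Y₂ Z₁ Z₂ (prj zero q) = id , id
PCase-pairD S X Y₁ Y₂ Z₁ Z₂ (prj (suc zero) q) = id , id
PCase-pairD S X Y₁ Y₂ Z₁ Z₂ (tag j) = [ (λ ()) , (λ ()) ] ∘ PCase-branch S X (pairD Y₁ Y₂) (pairD Z₁ Z₂) {tag j} , λ ()
PCase-pairD S X Y₁ Y₂ Z₁ Z₂ (inj j q) = [ (λ ()) , (λ ()) ] ∘ PCase-branch S X (pairD Y₁ Y₂) (pairD Z₁ Z₂) {inj j q} , λ ()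
PCase-pairD S X Y₁ Y₂ Z₁ Z₂ (fn W q) = [ (λ ()) , (λ ()) ] ∘ PCase-branch S X (pairD Y₁ Y₂) (pairD Z₁ Z₂) {fn W q} , λ ()

-- Applying pcase a Y Z to W: when a is empty, the two finite parts of W used by
-- Y and by Z are merged into one antichain.
apply-pcaseD : ∀ ρ₁ ρ₂ a Y Z W → IsElem ((ρ₁ ⇒ ρ₂) ↑) Y → IsElem ((ρ₁ ⇒ ρ₂) ↑) Z → IsElem (ρ₁ ↑) W →
               apply (pcaseD a Y Z) W ≐ pcaseD a (apply Y W) (apply Z W)
apply-pcaseD ρ₁ ρ₂ a Y Z W eY eZ eW p = to , from
  where
    to : apply (pcaseD a Y Z) W p → pcaseD a (apply Y W) (apply Z W) p
    to (Ws , wWs , pc) = pcaseD-map a Y (apply Y W) Z (apply Z W) (λ y → Ws , wWs , y) (λ z → Ws , wWs , z) pc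
    from : pcaseD a (apply Y W) (apply Z W) p → apply (pcaseD a Y Z) W p
    from (inj₂ (inj₁ (t , Ws , wWs , y))) = Ws , wWs , inj₂ (inj₁ (t , y))
    from (inj₂ (inj₂ (t , Ws , wWs , z))) = Ws , wWs , inj₂ (inj₂ (t , z))
    from (inj₁ (E , (W₁ , wW₁ , y) , (W₂ , wW₂ , z))) =
      let Ws , wWs , iWs , W₁₂⊆Ws = Antichain.antichain W (elem-cons eW) (W₁ ++ W₂) (++⁺ wW₁ wW₂)
          ppp = proj₂ (proj₂ (PP-fn⁻ ρ₁ ρ₂ W₁ p (elem-PP eY _ y)))
          pp-fn = PP-fn⁺ ρ₁ ρ₂ Ws p (All.map (elem-PP eW _) wWs) iWs ppp
          y' = elem-down eY (fn Ws p) (fn W₁ p) y pp-fn (⊆↓⇒Below W₁ Ws (λ q → W₁₂⊆Ws q ∘ ++⁺ˡ) , ⊑-refl p)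
          z' = elem-down eZ (fn Ws p) (fn W₂ p) z pp-fn (⊆↓⇒Below W₂ Ws (λ q → W₁₂⊆Ws q ∘ ++⁺ʳ W₁) , ⊑-refl p)
      in Ws , wWs , inj₁ (E , y' , z')

PCase-apply : ∀ S ρ₁ ρ₂ X Y Z W → IsElem ((ρ₁ ⇒ ρ₂) ↑) Y → IsElem ((ρ₁ ⇒ ρ₂) ↑) Z → IsElem (ρ₁ ↑) W →
              apply (PCase S X Y Z) W ≐ PCase S X (apply Y W) (apply Z W)
PCase-apply S ρ₁ ρ₂ X Y Z W eY eZ eW =
  ≐-trans (apply-PrF-comm S (λ a → pcaseD a Y Z) X W)
          (apply-resp (PrF-resp S (λ a → apply (pcaseD a Y Z) W) (λ a → pcaseD a (apply Y W) (apply Z W))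
                                 λ Xs _ → apply-pcaseD ρ₁ ρ₂ (down S Xs) Y Z W eY eZ eW)
                      ≐-refl)

skip : ℕ → Env → Env
skip c ε i σ = ε (if i <ᵇ c then i else suc i) σ

skip-extend : ∀ c ε d → EnvEq (skip (suc c) (extend ε d)) (extend (skip c ε) d)
skip-extend c ε d zero σ = ≐-refl
skip-extend c ε d (suc j) σ with j <ᵇ c
... | true = ≐-refl
... | false = ≐-refl

sem-shift : ∀ M c ε → ⟦ shift c M ⟧ ε ≐ ⟦ M ⟧ (skip c ε)
sem-shift (v i σ) c ε with i <ᵇ c
... | true = ≐-refl
... | false = ≐-refl
sem-shift (con _) c ε = ≐-refl
sem-shift (lam σ M) c ε =
  PrF-resp (σ ↑) _ _ λ X _ → ≐-trans (sem-shift M (suc c) (extend ε (down (σ ↑) X)))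
                                      (sem-resp M (skip-extend c ε (down (σ ↑) X)))
sem-shift (app M N) c ε = apply-resp (sem-shift M c ε) (sem-shift N c ε)

insertAt : ℕ → PSet → Env → Env
insertAt k d ε i σ = if i <ᵇ k then ε i σ else (if i ≡ᵇ k then d else ε (pred i) σ)

insertAt-extend : ∀ k D E ε d → D ≐ E → EnvEq (insertAt (suc k) D (extend ε d)) (extend (insertAt k E ε) d)
insertAt-extend k D E ε d h zero σ = ≐-refl
insertAt-extend zero D E ε d h (suc zero) σ = h
insertAt-extend (suc k) D E ε d h (suc zero) σ = ≐-refl
insertAt-extend k D E ε d h (suc (suc j)) σ with suc j <ᵇ k
... | true = ≐-refl
... | false with suc j ≡ᵇ k
... | true = h
... | false = ≐-refl

sem-sub : ∀ M k N ε → ⟦ sub k N M ⟧ ε ≐ ⟦ M ⟧ (insertAt k (⟦ N ⟧ ε) ε)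
sem-sub (v i σ) k N ε with i <ᵇ k
... | true = ≐-refl
... | false with i ≡ᵇ k
... | true = ≐-refl
... | false = ≐-refl
sem-sub (con _) k N ε = ≐-refl
sem-sub (lam σ M) k N ε =
  PrF-resp (σ ↑) _ _ λ X _ →
    let ε' = extend ε (down (σ ↑) X)
    in ≐-trans (sem-sub M (suc k) (shift 0 N) ε')
               (sem-resp M (insertAt-extend k _ _ ε (down (σ ↑) X) (sem-shift N 0 ε')))
sem-sub (app M M') k N ε = apply-resp (sem-sub M k N ε) (sem-sub M' k N ε)

sem-sub₀ : ∀ M N ε → ⟦ M [0:= N ] ⟧ ε ≐ ⟦ M ⟧ (extend ε (⟦ N ⟧ ε))
sem-sub₀ M N ε = ≐-trans (sem-sub M 0 N ε) (sem-resp M insert₀)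
  where insert₀ : EnvEq (insertAt 0 (⟦ N ⟧ ε) ε) (extend ε (⟦ N ⟧ ε))
        insert₀ zero σ = ≐-refl
        insert₀ (suc i) σ = ≐-refl

-- Inversion of typing.  Types are only determined up to ≈, because of tconv.

app-inv : ∀ {Γ M N τ} → Γ ⊢ app M N ∶ τ →
          ∃₂ λ σ τ' → (Γ ⊢ M ∶ (σ ⇒ τ')) × (Γ ⊢ N ∶ σ) × (τ' ≈ τ)
app-inv (tapp d e) = _ , _ , d , e , ≈-refl
app-inv (tconv d τ≈) = let σ , τ' , d₁ , d₂ , h = app-inv d in σ , τ' , d₁ , d₂ , ≈-trans h τ≈

lam-inv : ∀ {Γ σ M ρ} → Γ ⊢ lam σ M ∶ ρ → ∃ λ τ → ((σ ∷ Γ) ⊢ M ∶ τ) × ((σ ⇒ τ) ≈ ρ)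
lam-inv (tlam d) = _ , d , ≈-refl
lam-inv (tconv d ρ≈) = let τ , d' , h = lam-inv d in τ , d' , ≈-trans h ρ≈

Principal : List Type → Tm → Type → Set
Principal Γ M a = ∀ ρ → Γ ⊢ M ∶ ρ → a ≈ ρ

Principal-con : ∀ {Γ} c → Principal Γ (con c) (typeOf c)
Principal-con c ρ tcon = ≈-refl
Principal-con c ρ (tconv d ρ≈) = ≈-trans (Principal-con c _ d) ρ≈

Principal-app : ∀ {Γ M N a b} → Principal Γ M (a ⇒ b) → Principal Γ (app M N) b
Principal-app u ρ d = let _ , _ , d₁ , _ , h = app-inv d in ≈-trans (≈-comp fun (suc zero) (u _ d₁)) h

arg-typed : ∀ {Γ M N a b τ} → Principal Γ M (a ⇒ b) → Γ ⊢ app M N ∶ τ → Γ ⊢ N ∶ a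
arg-typed u d = let _ , _ , d₁ , d₂ , _ = app-inv d in tconv d₂ (≈-sym (≈-comp fun zero (u _ d₁)))

_·*_ : Tm → List Tm → Tm
M ·* [] = M
M ·* (A ∷ As) = (M · A) ·* As

_⇛_ : List Type → Type → Type
[] ⇛ r = r
(a ∷ as) ⇛ r = a ⇒ (as ⇛ r)

Args : List Type → List Tm → List Type → Set
Args Γ [] [] = ⊤
Args Γ (A ∷ As) (a ∷ as) = (Γ ⊢ A ∶ a) × Args Γ As as
Args Γ _ _ = ⊥

spine-head : ∀ {Γ M τ} As → Γ ⊢ M ·* As ∶ τ → ∃ λ ρ → Γ ⊢ M ∶ ρ
spine-head [] d = _ , d
spine-head (A ∷ As) d = let _ , d' = spine-head As d ; _ , _ , dM , _ = app-inv d' in _ , dM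

spine : ∀ {Γ M r τ} As as → length As ≡ length as → Principal Γ M (as ⇛ r) → Γ ⊢ M ·* As ∶ τ →
        Args Γ As as × (r ≈ τ)
spine [] [] _ u d = tt , u _ d
spine (A ∷ As) (a ∷ as) eq u d =
  let _ , dMA = spine-head As d
      args , r≈ = spine As as (suc-injective eq) (Principal-app u) d
  in (arg-typed u dMA , args) , r≈

-- Γ with ρ inserted at position c (free variables beyond Γ are unconstrained)
insC : ℕ → Type → List Type → List Type
insC zero ρ Γ = ρ ∷ Γ
insC (suc c) ρ [] = []
insC (suc c) ρ (τ ∷ Γ) = τ ∷ insC c ρ Γ

varOK-shift : ∀ c ρ Γ i σ → VarOK Γ i σ →
              ((i <ᵇ c) ≡ true → VarOK (insC c ρ Γ) i σ) × ((i <ᵇ c) ≡ false → VarOK (insC c ρ Γ) (suc i) σ)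
varOK-shift zero ρ Γ i σ ok = (λ ()) , λ _ → ok
varOK-shift (suc c) ρ [] i σ ok = (λ _ → tt) , (λ _ → tt)
varOK-shift (suc c) ρ (τ ∷ Γ) zero σ ok = (λ _ → ok) , λ ()
varOK-shift (suc c) ρ (τ ∷ Γ) (suc i) σ ok = varOK-shift c ρ Γ i σ ok

ty-shift : ∀ {Γ M τ} c ρ → Γ ⊢ M ∶ τ → insC c ρ Γ ⊢ shift c M ∶ τ
ty-shift {Γ} c ρ (tv {i} {σ} ok) with i <ᵇ c in lt
... | true = tv (proj₁ (varOK-shift c ρ Γ i σ ok) lt)
... | false = tv (proj₂ (varOK-shift c ρ Γ i σ ok) lt)
ty-shift c ρ tcon = tcon
ty-shift c ρ (tlam d) = tlam (ty-shift (suc c) ρ d)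
ty-shift c ρ (tapp d e) = tapp (ty-shift c ρ d) (ty-shift c ρ e)
ty-shift c ρ (tconv d h) = tconv (ty-shift c ρ d) h

varOK-insC : ∀ k σ Γ i σ' → k ≤ length Γ → VarOK (insC k σ Γ) i σ' →
             ((i <ᵇ k) ≡ true → VarOK Γ i σ') ×
             ((i <ᵇ k) ≡ false → (i ≡ᵇ k) ≡ true → σ ≡ σ') ×
             ((i <ᵇ k) ≡ false → (i ≡ᵇ k) ≡ false → VarOK Γ (pred i) σ')
varOK-insC zero σ Γ zero σ' _ ok = (λ ()) , (λ _ _ → ok) , (λ _ ())
varOK-insC zero σ Γ (suc i) σ' _ ok = (λ ()) , (λ _ ()) , (λ _ _ → ok)
varOK-insC (suc k) σ (ρ ∷ Γ) zero σ' _ ok = (λ _ → ok) , (λ ()) , (λ ())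
varOK-insC (suc zero) σ (ρ ∷ Γ) (suc zero) σ' _ ok = (λ ()) , (λ _ _ → ok) , (λ _ ())
varOK-insC (suc (suc k)) σ (ρ ∷ Γ) (suc zero) σ' (s≤s le) ok =
  let below , at , _ = varOK-insC (suc k) σ Γ zero σ' le ok in below , at , λ ()
varOK-insC (suc k) σ (ρ ∷ Γ) (suc (suc i)) σ' (s≤s le) ok = varOK-insC k σ Γ (suc i) σ' le ok

ty-sub : ∀ {Γ M τ N σ} k → k ≤ length Γ → insC k σ Γ ⊢ M ∶ τ → Γ ⊢ N ∶ σ → Γ ⊢ sub k N M ∶ τ
ty-sub {Γ} {N = N} {σ} k le (tv {i} {σ'} ok) dN with varOK-insC k σ Γ i σ' le ok | i <ᵇ k in lt | i ≡ᵇ k in eq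
... | below , _ , _ | true | _ = tv (below lt)
... | _ , at , _ | false | true = subst (Γ ⊢ N ∶_) (at lt eq) dN
... | _ , _ , above | false | false = tv (above lt eq)
ty-sub k le tcon dN = tcon
ty-sub k le (tlam d) dN = tlam (ty-sub (suc k) (s≤s le) d (ty-shift 0 _ dN))
ty-sub k le (tapp d e) dN = tapp (ty-sub k le d dN) (ty-sub k le e dN)
ty-sub k le (tconv d h) dN = tconv (ty-sub k le d dN) h

Principal-inC : ∀ {Γ} i σ τ → Principal Γ (con (inC i σ τ)) (sel i σ τ ⇒ (σ ⊕ τ))
Principal-inC zero σ τ = Principal-con (c0 σ τ)
Principal-inC (suc zero) σ τ = Principal-con (c1 σ τ)

Principal-projC : ∀ {Γ} i σ τ → Principal Γ (con (projC i σ τ)) ((σ ⊗ τ) ⇒ sel i σ τ)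
Principal-projC zero σ τ = Principal-con (cfst σ τ)
Principal-projC (suc zero) σ τ = Principal-con (csnd σ τ)

inC-typed : ∀ {Γ} i σ τ → Γ ⊢ con (inC i σ τ) ∶ (sel i σ τ ⇒ (σ ⊕ τ))
inC-typed zero σ τ = tcon
inC-typed (suc zero) σ τ = tcon

sel-typed : ∀ i {Γ M N σ τ} (F : Type → Type) → Γ ⊢ M ∶ F σ → Γ ⊢ N ∶ F τ → Γ ⊢ sel i M N ∶ F (sel i σ τ)
sel-typed zero F dM dN = dM
sel-typed (suc zero) F dM dN = dN

Sound : List Type → Tm → Tm → Type → Set₁
Sound Γ M N τ = (Γ ⊢ N ∶ τ) × (∀ ε → EnvOK Γ ε → ⟦ M ⟧ ε ≐ ⟦ N ⟧ ε)

rule-β : ∀ {Γ σ M N τ} → Γ ⊢ app (lam σ M) N ∶ τ → Sound Γ (app (lam σ M) N) (M [0:= N ]) τ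
rule-β {Γ} {σ} {M} {N} D =
  let _ , _ , dL , dN , h = app-inv D
      _ , dM , h' = lam-inv dL
      dN' = tconv dN (≈-sym (≈-comp fun zero h'))
  in tconv (ty-sub 0 z≤n dM dN') (≈-trans (≈-comp fun (suc zero) h') h) ,
     λ ε ok → ≐-trans (beta-lam σ M ε (⟦ N ⟧ ε) (sound dN' ε ok)) (≐-sym (sem-sub₀ M N ε))

rule-case : ∀ i {Γ σ τ ρ α₀ α₁ x y z τ₀} → Γ ⊢ con (ccase σ τ ρ) · (con (inC i α₀ α₁) · x) · y · z ∶ τ₀ →
            Sound Γ (con (ccase σ τ ρ) · (con (inC i α₀ α₁) · x) · y · z) (sel i y z · x) τ₀
rule-case i {Γ} {σ} {τ} {ρ} {α₀} {α₁} {x} {y} {z} D =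
  let (tA , tY , tZ , _) , r≈ = spine (_ ∷ y ∷ z ∷ []) ((σ ⊕ τ) ∷ (σ ⇒ ρ) ∷ (τ ⇒ ρ) ∷ []) refl (Principal-con _) D
      (tx , _) , h = spine (x ∷ []) (sel i α₀ α₁ ∷ []) refl (Principal-inC i α₀ α₁) tA
  in tconv (tapp (sel-typed i (_⇒ ρ) tY tZ) (tconv tx (≈-comp sum i h))) r≈ ,
     λ ε ok →
       let X = ⟦ x ⟧ ε ; Y = ⟦ y ⟧ ε ; Z = ⟦ z ⟧ ε ; A = apply ⟦ inC i α₀ α₁ ⟧ᶜ X
           open ≐-Reasoning
       in begin
          apply (apply (apply ⟦ ccase σ τ ρ ⟧ᶜ A) Y) Z ≈⟨ sem-case σ τ ρ A Y Z (sound tA ε ok) (sound tY ε ok) (sound tZ ε ok) ⟩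
          caseD A Y Z                                 ≈⟨ caseD-resp (sem-inC i α₀ α₁ X (sound tx ε ok)) (≐-refl {Y}) (≐-refl {Z}) ⟩
          caseD (inD i X) Y Z                         ≈⟨ caseD-inD i X Y Z ⟩
          apply (sel i Y Z) X                         ≡⟨ cong (λ r → apply r X) (sel-natural (λ t → ⟦ t ⟧ ε) i y z) ⟨
          ⟦ sel i y z · x ⟧ ε                         ∎

rule-proj : ∀ i {Γ σ τ α₀ α₁ x y τ₀} → Γ ⊢ con (projC i σ τ) · (con (cpair α₀ α₁) · x · y) ∶ τ₀ →
            Sound Γ (con (projC i σ τ) · (con (cpair α₀ α₁) · x · y)) (sel i x y) τ₀
rule-proj i {Γ} {σ} {τ} {α₀} {α₁} {x} {y} D =
  let (tP , _) , r≈ = spine (_ ∷ []) ((σ ⊗ τ) ∷ []) refl (Principal-projC i σ τ) D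
      (tx , ty , _) , h = spine (x ∷ y ∷ []) (α₀ ∷ α₁ ∷ []) refl (Principal-con _) tP
  in tconv (tconv (sel-typed i id tx ty) (≈-comp prod i h)) r≈ ,
     λ ε ok →
       let X = ⟦ x ⟧ ε ; Y = ⟦ y ⟧ ε ; P = apply (apply ⟦ cpair α₀ α₁ ⟧ᶜ X) Y
           open ≐-Reasoning
       in begin
          apply ⟦ projC i σ τ ⟧ᶜ P ≈⟨ sem-projC i σ τ P (sound tP ε ok) ⟩
          projD i P                ≈⟨ (λ a → sem-pair α₀ α₁ X Y (sound tx ε ok) (sound ty ε ok) (prj i a)) ⟩
          projD i (pairD X Y)      ≡⟨ projD-pairD i X Y ⟩
          sel i X Y                ≡⟨ sel-natural (λ t → ⟦ t ⟧ ε) i x y ⟨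
          ⟦ sel i x y ⟧ ε          ∎

rule-pcase : ∀ i {Γ σ τ ρ α₀ α₁ x y z τ₀} → Γ ⊢ con (cpcase σ τ ρ) · (con (inC i α₀ α₁) · x) · y · z ∶ τ₀ →
             Sound Γ (con (cpcase σ τ ρ) · (con (inC i α₀ α₁) · x) · y · z) (sel i y z) τ₀
rule-pcase i {Γ} {σ} {τ} {ρ} {α₀} {α₁} {x} {y} {z} D =
  let (tA , tY , tZ , _) , r≈ = spine (_ ∷ y ∷ z ∷ []) ((σ ⊕ τ) ∷ ρ ∷ ρ ∷ []) refl (Principal-con _) D
      (tx , _) , _ = spine (x ∷ []) (sel i α₀ α₁ ∷ []) refl (Principal-inC i α₀ α₁) tA
  in tconv (sel-typed i {σ = ρ} {τ = ρ} (λ _ → ρ) tY tZ) r≈ ,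
     λ ε ok →
       let X = ⟦ x ⟧ ε ; Y = ⟦ y ⟧ ε ; Z = ⟦ z ⟧ ε ; A = apply ⟦ inC i α₀ α₁ ⟧ᶜ X
           Aᵢ = ⊆-of (≐-sym (sem-inC i α₀ α₁ X (sound tx ε ok))) (tag i) refl
           open ≐-Reasoning
       in begin
          apply (apply (apply ⟦ cpcase σ τ ρ ⟧ᶜ A) Y) Z ≈⟨ sem-pcase σ τ ρ A Y Z (sound tY ε ok) (sound tZ ε ok) ⟩
          PCase ((σ ⊕ τ) ↑) A Y Z                      ≈⟨ PCase-tagged _ i A Y Z (sound tA ε ok) Aᵢ ⟩
          sel i Y Z                                    ≡⟨ sel-natural (λ t → ⟦ t ⟧ ε) i y z ⟨
          ⟦ sel i y z ⟧ ε                              ∎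

rule-pcase⊕ : ∀ i {Γ σ τ ρ₀ ρ₁ α₀ α₁ α₀' α₁' x y z τ₀} →
              Γ ⊢ con (cpcase σ τ (ρ₀ ⊕ ρ₁)) · x · (con (inC i α₀ α₁) · y) · (con (inC i α₀' α₁') · z) ∶ τ₀ →
              Sound Γ (con (cpcase σ τ (ρ₀ ⊕ ρ₁)) · x · (con (inC i α₀ α₁) · y) · (con (inC i α₀' α₁') · z))
                      (con (inC i ρ₀ ρ₁) · (con (cpcase σ τ (sel i ρ₀ ρ₁)) · x · y · z)) τ₀
rule-pcase⊕ i {Γ} {σ} {τ} {ρ₀} {ρ₁} {α₀} {α₁} {α₀'} {α₁'} {x} {y} {z} D =
  let (tx , tY , tZ , _) , r≈ = spine (x ∷ _ ∷ _ ∷ []) ((σ ⊕ τ) ∷ (ρ₀ ⊕ ρ₁) ∷ (ρ₀ ⊕ ρ₁) ∷ []) refl (Principal-con _) D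
      (ty , _) , h₁ = spine (y ∷ []) (sel i α₀ α₁ ∷ []) refl (Principal-inC i α₀ α₁) tY
      (tz , _) , h₂ = spine (z ∷ []) (sel i α₀' α₁' ∷ []) refl (Principal-inC i α₀' α₁') tZ
      ty' = tconv ty (≈-comp sum i h₁)
      tz' = tconv tz (≈-comp sum i h₂)
      tW = tapp (tapp (tapp tcon tx) ty') tz'
  in tconv (tapp (inC-typed i ρ₀ ρ₁) tW) r≈ ,
     λ ε ok →
       let X = ⟦ x ⟧ ε ; Y = ⟦ y ⟧ ε ; Z = ⟦ z ⟧ ε ; S = (σ ⊕ τ) ↑
           Y' = apply ⟦ inC i α₀ α₁ ⟧ᶜ Y ; Z' = apply ⟦ inC i α₀' α₁' ⟧ᶜ Z
           W = ⟦ con (cpcase σ τ (sel i ρ₀ ρ₁)) · x · y · z ⟧ ε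
           open ≐-Reasoning
       in begin
          apply (apply (apply ⟦ cpcase σ τ (ρ₀ ⊕ ρ₁) ⟧ᶜ X) Y') Z'
            ≈⟨ sem-pcase σ τ (ρ₀ ⊕ ρ₁) X Y' Z' (sound tY ε ok) (sound tZ ε ok) ⟩
          PCase S X Y' Z'
            ≈⟨ PCase-resp S X (sem-inC i α₀ α₁ Y (sound ty ε ok)) (sem-inC i α₀' α₁' Z (sound tz ε ok)) ⟩
          PCase S X (inD i Y) (inD i Z)
            ≈⟨ PCase-inD S i X Y Z ⟩
          inD i (PCase S X Y Z)
            ≈⟨ inD-resp i (sem-pcase σ τ (sel i ρ₀ ρ₁) X Y Z (sound ty' ε ok) (sound tz' ε ok)) ⟨
          inD i W
            ≈⟨ sem-inC i ρ₀ ρ₁ W (sound tW ε ok) ⟨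
          apply ⟦ inC i ρ₀ ρ₁ ⟧ᶜ W ∎

rule-pcase⊗ : ∀ {Γ σ τ ρ₁ ρ₂ α₁ α₂ α₁' α₂' x y₁ y₂ z₁ z₂ τ₀} →
              Γ ⊢ con (cpcase σ τ (ρ₁ ⊗ ρ₂)) · x · (con (cpair α₁ α₂) · y₁ · y₂) · (con (cpair α₁' α₂') · z₁ · z₂) ∶ τ₀ →
              Sound Γ (con (cpcase σ τ (ρ₁ ⊗ ρ₂)) · x · (con (cpair α₁ α₂) · y₁ · y₂) · (con (cpair α₁' α₂') · z₁ · z₂))
                      (con (cpair ρ₁ ρ₂) · (con (cpcase σ τ ρ₁) · x · y₁ · z₁) · (con (cpcase σ τ ρ₂) · x · y₂ · z₂)) τ₀
rule-pcase⊗ {Γ} {σ} {τ} {ρ₁} {ρ₂} {α₁} {α₂} {α₁'} {α₂'} {x} {y₁} {y₂} {z₁} {z₂} D =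
  let (tx , tY , tZ , _) , r≈ = spine (x ∷ _ ∷ _ ∷ []) ((σ ⊕ τ) ∷ (ρ₁ ⊗ ρ₂) ∷ (ρ₁ ⊗ ρ₂) ∷ []) refl (Principal-con _) D
      (ty₁ , ty₂ , _) , h₁ = spine (y₁ ∷ y₂ ∷ []) (α₁ ∷ α₂ ∷ []) refl (Principal-con _) tY
      (tz₁ , tz₂ , _) , h₂ = spine (z₁ ∷ z₂ ∷ []) (α₁' ∷ α₂' ∷ []) refl (Principal-con _) tZ
      ty₁' = tconv ty₁ (≈-comp prod zero h₁) ; ty₂' = tconv ty₂ (≈-comp prod (suc zero) h₁)
      tz₁' = tconv tz₁ (≈-comp prod zero h₂) ; tz₂' = tconv tz₂ (≈-comp prod (suc zero) h₂)
      tW₁ = tapp (tapp (tapp tcon tx) ty₁') tz₁'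
      tW₂ = tapp (tapp (tapp tcon tx) ty₂') tz₂'
  in tconv (tapp (tapp tcon tW₁) tW₂) r≈ ,
     λ ε ok →
       let X = ⟦ x ⟧ ε ; Y₁ = ⟦ y₁ ⟧ ε ; Y₂ = ⟦ y₂ ⟧ ε ; Z₁ = ⟦ z₁ ⟧ ε ; Z₂ = ⟦ z₂ ⟧ ε ; S = (σ ⊕ τ) ↑
           Y = apply (apply ⟦ cpair α₁ α₂ ⟧ᶜ Y₁) Y₂ ; Z = apply (apply ⟦ cpair α₁' α₂' ⟧ᶜ Z₁) Z₂
           W₁ = ⟦ con (cpcase σ τ ρ₁) · x · y₁ · z₁ ⟧ ε ; W₂ = ⟦ con (cpcase σ τ ρ₂) · x · y₂ · z₂ ⟧ ε
           open ≐-Reasoning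
       in begin
          apply (apply (apply ⟦ cpcase σ τ (ρ₁ ⊗ ρ₂) ⟧ᶜ X) Y) Z
            ≈⟨ sem-pcase σ τ (ρ₁ ⊗ ρ₂) X Y Z (sound tY ε ok) (sound tZ ε ok) ⟩
          PCase S X Y Z
            ≈⟨ PCase-resp S X (sem-pair α₁ α₂ Y₁ Y₂ (sound ty₁ ε ok) (sound ty₂ ε ok))
                              (sem-pair α₁' α₂' Z₁ Z₂ (sound tz₁ ε ok) (sound tz₂ ε ok)) ⟩
          PCase S X (pairD Y₁ Y₂) (pairD Z₁ Z₂)
            ≈⟨ PCase-pairD S X Y₁ Y₂ Z₁ Z₂ ⟩
          pairD (PCase S X Y₁ Z₁) (PCase S X Y₂ Z₂)
            ≈⟨ pairD-resp (sem-pcase σ τ ρ₁ X Y₁ Z₁ (sound ty₁' ε ok) (sound tz₁' ε ok))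
                          (sem-pcase σ τ ρ₂ X Y₂ Z₂ (sound ty₂' ε ok) (sound tz₂' ε ok)) ⟨
          pairD W₁ W₂
            ≈⟨ sem-pair ρ₁ ρ₂ W₁ W₂ (sound tW₁ ε ok) (sound tW₂ ε ok) ⟨
          apply (apply ⟦ cpair ρ₁ ρ₂ ⟧ᶜ W₁) W₂ ∎

rule-pcase⇒ : ∀ {Γ σ τ ρ₁ ρ₂ x y z w τ₀} →
              Γ ⊢ con (cpcase σ τ (ρ₁ ⇒ ρ₂)) · x · y · z · w ∶ τ₀ →
              Sound Γ (con (cpcase σ τ (ρ₁ ⇒ ρ₂)) · x · y · z · w) (con (cpcase σ τ ρ₂) · x · (y · w) · (z · w)) τ₀
rule-pcase⇒ {Γ} {σ} {τ} {ρ₁} {ρ₂} {x} {y} {z} {w} D =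
  let (tx , ty , tz , tw , _) , r≈ =
        spine (x ∷ y ∷ z ∷ w ∷ []) ((σ ⊕ τ) ∷ (ρ₁ ⇒ ρ₂) ∷ (ρ₁ ⇒ ρ₂) ∷ ρ₁ ∷ []) refl (Principal-con _) D
  in tconv (tapp (tapp (tapp tcon tx) (tapp ty tw)) (tapp tz tw)) r≈ ,
     λ ε ok →
       let X = ⟦ x ⟧ ε ; Y = ⟦ y ⟧ ε ; Z = ⟦ z ⟧ ε ; W = ⟦ w ⟧ ε ; S = (σ ⊕ τ) ↑
           eY = sound ty ε ok ; eZ = sound tz ε ok ; eW = sound tw ε ok
           open ≐-Reasoning
       in begin
          apply (apply (apply (apply ⟦ cpcase σ τ (ρ₁ ⇒ ρ₂) ⟧ᶜ X) Y) Z) W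
            ≈⟨ apply-resp (sem-pcase σ τ (ρ₁ ⇒ ρ₂) X Y Z eY eZ) (≐-refl {W}) ⟩
          apply (PCase S X Y Z) W
            ≈⟨ PCase-apply S ρ₁ ρ₂ X Y Z W eY eZ eW ⟩
          PCase S X (apply Y W) (apply Z W)
            ≈⟨ sem-pcase σ τ ρ₂ X (apply Y W) (apply Z W) (apply-elem ρ₁ ρ₂ Y W eY eW) (apply-elem ρ₁ ρ₂ Z W eZ eW) ⟨
          apply (apply (apply ⟦ cpcase σ τ ρ₂ ⟧ᶜ X) (apply Y W)) (apply Z W) ∎

step-sound : ∀ {Γ M N τ} → Γ ⊢ M ∶ τ → M ⟶ N → Sound Γ M N τ
step-sound D β = rule-β D
step-sound D (appˡ {N = N} r) =
  let _ , _ , dM , dN , h = app-inv D ; dM' , M≐M' = step-sound dM r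
  in tconv (tapp dM' dN) h , λ ε ok → apply-resp (M≐M' ε ok) (≐-refl {⟦ N ⟧ ε})
step-sound D (appʳ {M = M} r) =
  let _ , _ , dM , dN , h = app-inv D ; dN' , N≐N' = step-sound dN r
  in tconv (tapp dM dN') h , λ ε ok → apply-resp (≐-refl {⟦ M ⟧ ε}) (N≐N' ε ok)
step-sound D (lamξ {σ} {M} {M'} r) =
  let _ , dM , h = lam-inv D ; dM' , M≐M' = step-sound dM r
  in tconv (tlam dM') h ,
     λ ε ok → PrF-resp (σ ↑) (λ d → ⟦ M ⟧ (extend ε d)) (λ d → ⟦ M' ⟧ (extend ε d))
                λ X fX → M≐M' (extend ε (down (σ ↑) X)) (EnvOK-extend ok (FinElem-elem _ X fX))
step-sound D case0 = rule-case zero D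
step-sound D case1 = rule-case (suc zero) D
step-sound D fstβ = rule-proj zero D
step-sound D sndβ = rule-proj (suc zero) D
step-sound D pcase0 = rule-pcase zero D
step-sound D pcase1 = rule-pcase (suc zero) D
step-sound D pcase⊕0 = rule-pcase⊕ zero D
step-sound D pcase⊕1 = rule-pcase⊕ (suc zero) D
step-sound D pcase⊗ = rule-pcase⊗ D
step-sound D pcase⇒ = rule-pcase⇒ D

reduction-sound : ∀ {Γ M N τ} → Γ ⊢ M ∶ τ → M ⟶* N → Sound Γ M N τ
reduction-sound D done = D , λ ε ok → ≐-refl
reduction-sound D (s ◅ r) =
  let D' , M≐M' = step-sound D s ; D'' , M'≐N = reduction-sound D' r
  in D'' , λ ε ok → ≐-trans (M≐M' ε ok) (M'≐N ε ok)

-- In the empty context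
-- every variable is free, and a valid environment maps each to an element of its
-- type; the typing of N follows from that of M by subject reduction.
mainTheorem5 : (M N : Tm) → Typed M → Typed N → M ⟶* N →
               (ε : Env) → ValidEnv ε → ⟦ M ⟧ ε ≐ ⟦ N ⟧ ε
mainTheorem5 M N (σ , dM) _ r ε valid = proj₂ (reduction-sound dM r) ε (λ i τ _ → valid i τ)
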